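{- Let $\mathcal{F}$ be a family of finite posets that is closed under taking order ideals and order filters, and such that for every $P\in\mathcal{F}$ the coefficient of the linear term of the order polynomial $\Omega_P(n)$ is nonnegative. Then for any $P\in\mathcal{F}$, any subset $A\subseteq P$ (with the induced order) with $\min(P)\cup\max(P)\subseteq A$, and any $\lambda\colon A\to\mathbb{Z}$, the marked order polytope $\mathcal{O}_{P,A}(\lambda)$ is Ehrhart positive.
   Context: For a finite poset $P$ and a positive integer $n$, $\Omega_P(n)$ (the order polynomial) is the number of order preserving maps $g\colon P\to\{1,\ldots,n\}$ (i.e. $g(p)\le g(q)$ whenever $p\prec_P q$); it is a polynomial in $n$. Ideals are downward closed subsets, filters upward closed subsets; the family being closed under them means the induced subposet on any ideal or filter of a member is again a member. $\min(P),\max(P)$ are the sets of minimal and maximal elements. The marked order polytope is $\mathcal{O}_{P,A}(\lambda)=\{\hat\lambda\colon P\to\mathbb{R}\text{ order preserving with }\hat\lambda(a)=\lambda(a)\ \forall a\in A\}\subset\mathbb{R}^P$; when $\min(P)\cup\max(P)\subseteq A$ and $\lambda$ is integer-valued it is a (possibly empty) lattice polytope. A lattice polytope $Q\subset\mathbb{R}^d$ is Ehrhart positive if its Ehrhart polynomial $E_Q(n)=|nQ\cap\mathbb{Z}^d|$ ($n\ge0$) has only nonnegative coefficients. -}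

module Defs where

open import Level using (0ℓ)
open import Data.Nat as ℕ using (ℕ; suc)
open import Data.Fin as Fin using (Fin)
open import Data.Fin.Subset using (Subset; _∈_)
open import Data.Vec using (Vec; lookup)
open import Data.List using (List; []; _∷_)
open import Data.Integer as ℤ using (ℤ; +_)
open import Data.Rational as ℚ using (ℚ; 0ℚ)
open import Data.Sum using (_⊎_)
open import Data.Product using (Σ; ∃; _×_; _,_)
open import Function.Definitions using (Injective)
open import Relation.Binary.Core using (Rel)
open import Relation.Binary.Structures using (IsPartialOrder)
open import Relation.Binary.PropositionalEquality using (_≡_)
open import Data.List.Relation.Unary.All using (All)

record FinPoset : Set₁ where
  field
    size  : ℕ
    _≼_   : Rel (Fin size) 0ℓ
    isPO  : IsPartialOrder _≡_ _≼_
open FinPoset public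

Card : (X : Set) → (X → Set) → ℕ → Set
Card X P k =
  Σ (Fin k → X) λ f →
    Injective _≡_ _≡_ f × (∀ i → P (f i)) × (∀ x → P x → ∃ λ i → f i ≡ x)

-- Polynomials with rational coefficients: coefficient lists c₀ ∷ c₁ ∷ …
eval : List ℚ → ℚ → ℚ
eval []       x = 0ℚ
eval (c ∷ cs) x = c ℚ.+ x ℚ.* eval cs x

coeff : List ℚ → ℕ → ℚ
coeff []       i       = 0ℚ
coeff (c ∷ cs) ℕ.zero  = c
coeff (c ∷ cs) (suc i) = coeff cs i

toℚ : ℕ → ℚ
toℚ k = (+ k) ℚ./ 1

Represents : List ℚ → (ℕ → ℕ → Set) → Set
Represents p cnt = ∀ n → 1 ℕ.≤ n → ∃ λ k → cnt n k × toℚ k ≡ eval p (toℚ n)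

-- Order preserving maps g : P → {1,…,n}  (encoded as Fin n, order preserved)
OrderPreserving : (P : FinPoset) (n : ℕ) → Vec (Fin n) (size P) → Set
OrderPreserving P n g = ∀ p q → _≼_ P p q → lookup g p Fin.≤ lookup g q

OrderPolyValue : FinPoset → ℕ → ℕ → Set
OrderPolyValue P n k = Card (Vec (Fin n) (size P)) (OrderPreserving P n) k

LinearCoeffNonneg : FinPoset → Set
LinearCoeffNonneg P =
  ∃ λ c → Represents c (OrderPolyValue P) × (0ℚ ℚ.≤ coeff c 1)

IsIdeal : (P : FinPoset) → Subset (size P) → Set
IsIdeal P I = ∀ p q → _≼_ P p q → q ∈ I → p ∈ I

IsFilter : (P : FinPoset) → Subset (size P) → Set
IsFilter P I = ∀ p q → _≼_ P p q → p ∈ I → q ∈ I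

IsInducedSubposet : (P : FinPoset) → Subset (size P) → FinPoset → Set
IsInducedSubposet P S Q =
  Σ (Fin (size Q) → Fin (size P)) λ e →
    Injective _≡_ _≡_ e × (∀ i → e i ∈ S) × (∀ x → x ∈ S → ∃ λ i → e i ≡ x)
    × (∀ i j → (_≼_ Q i j → _≼_ P (e i) (e j)) × (_≼_ P (e i) (e j) → _≼_ Q i j))

ClosedUnderIdealsFilters : (FinPoset → Set) → Set₁
ClosedUnderIdealsFilters F =
  ∀ P → F P → ∀ (S : Subset (size P)) → (IsIdeal P S ⊎ IsFilter P S)
    → ∀ Q → IsInducedSubposet P S Q → F Q

IsMinimal : (P : FinPoset) → Fin (size P) → Set
IsMinimal P p = ∀ q → _≼_ P q p → q ≡ p

IsMaximal : (P : FinPoset) → Fin (size P) → Set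
IsMaximal P p = ∀ q → _≼_ P p q → q ≡ p

MinMaxMarked : (P : FinPoset) → Subset (size P) → Set
MinMaxMarked P A = ∀ p → (IsMinimal P p ⊎ IsMaximal P p) → p ∈ A

Marking : (P : FinPoset) → Subset (size P) → Set
Marking P A = ∀ a → a ∈ A → ℤ

-- lattice points of the n-th dilate n·O_{P,A}(λ) = O_{P,A}(n λ):
-- integer order preserving g with g(a) = n λ(a) on A
InDilatedMOP : (P : FinPoset) (A : Subset (size P)) (λ' : Marking P A)
               (n : ℕ) → Vec ℤ (size P) → Set
InDilatedMOP P A λ' n g =
  (∀ p q → _≼_ P p q → lookup g p ℤ.≤ lookup g q)
  × (∀ a (h : a ∈ A) → lookup g a ≡ (+ n) ℤ.* λ' a h)

EhrhartValue : (P : FinPoset) (A : Subset (size P)) (λ' : Marking P A) → ℕ → ℕ → Set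
EhrhartValue P A λ' n k = Card (Vec ℤ (size P)) (InDilatedMOP P A λ' n) k

EhrhartPositiveMOP : (P : FinPoset) (A : Subset (size P)) → Marking P A → Set
EhrhartPositiveMOP P A λ' =
  ∃ λ c → Represents c (EhrhartValue P A λ') × All (0ℚ ℚ.≤_) c

-- Cutting an order preserving map P → {1, …, x + y} at x splits P into the filter U of elements
-- with values above x and the ideal P ∖ U, so that Ω_P (x + y) = Σ_U Ω_U (y) · Ω_{P∖U} (x).
-- Comparing the coefficients of y¹ and y⁰ on both sides, and inducting on |P| within the family,
-- shows that every Ω_P has nonnegative coefficients and, for P ≠ ∅, zero constant term: the
-- coefficient of y¹ only involves the linear coefficients of the Ω_U, nonnegative by hypothesis.
--
-- As min(P) ∪ max(P) ⊆ A, the lattice points of n · O_{P,A}(λ) are the order preserving maps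
-- g : P → ℤ with n · lo ≤ g ≤ n · hi, for integer bounds lo ≤ hi with values in some [a, a + d].
-- Cutting such maps at n (a + d - 1) splits off a top layer, which is counted by Ω_{P′} (n) for an
-- ideal P′ of a filter of P (the rest of the filter being forced to the top value), from a box of
-- height d - 1.  By induction on d the count is a sum of products of polynomials with nonnegative
-- coefficients.

module Submission where

open import Function using (_∘_; id)
open import Function.Definitions using (Injective)
open import Data.Empty using (⊥-elim)
open import Data.Nat as ℕ using (ℕ; zero; suc; s≤s)
import Data.Nat.Properties as ℕ
open import Data.Nat.Induction using (<-wellFounded)
open import Data.Integer as ℤ using (ℤ; +_)
import Data.Integer.Properties as ℤ
open import Data.Integer.Tactic.RingSolver using (solve-∀)
open import Data.Rational as ℚ using (ℚ; 0ℚ; 1ℚ)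
import Data.Rational.Properties as ℚ
import Data.Rational.Unnormalised as ℚᵘ
import Data.Rational.Unnormalised.Properties as ℚᵘ
open import Data.Rational.Solver using (module +-*-Solver)
open import Data.Fin as Fin using (Fin; zero; suc)
import Data.Fin.Properties as Fin
open import Data.Fin.Subset using (Subset; inside; outside; _∈_; _⊂_; ∣_∣; ∁; ⊤; ⊥)
open import Data.Fin.Subset.Properties
  using (_∈?_; x∉p⇒x∈∁p; x∈∁p⇒x∉p; ⊆-antisym; p⊂q⇒∣p∣<∣q∣; ∣p∣≤n; ∣∁p∣≡n∸∣p∣; ∣p∣≡n⇒p≡⊤; ∣⊥∣≡0;
         Empty-unique; ∈⊤; ∉⊥)
open import Data.Vec as Vec using (Vec; []; _∷_; lookup; tabulate; here; there)
import Data.Vec.Properties as Vec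
open import Data.Vec.Properties.WithK using ([]=-irrelevant)
open import Data.List using (List; []; _∷_; length; map)
open import Data.List.Relation.Unary.All using (All; []; _∷_)
open import Data.Product using (∃; ∃₂; _×_; _,_; proj₁; proj₂; uncurry)
open import Data.Sum using (_⊎_; inj₁; inj₂)
open import Induction.WellFounded using (Acc; acc)
open import Relation.Nullary using (¬_; contradiction; Dec; yes; no; does)
open import Relation.Nullary.Decidable
  using (dec-true; decidable-stable; ¬¬-excluded-middle; map′; _×-dec_; _→-dec_; ¬?)
open import Relation.Unary using (Decidable)
open import Relation.Binary.Structures using (IsPartialOrder)
open import Relation.Binary.PropositionalEquality

open import Defs

open +-*-Solver using (solve; _:+_; _:*_; :-_; _:=_; con)

toℚᵘ-toℚ : ∀ k → ℚ.toℚᵘ (toℚ k) ℚᵘ.≃ ℚᵘ.mkℚᵘ (+ k) 0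
toℚᵘ-toℚ k = ℚ.toℚᵘ-fromℚᵘ (ℚᵘ.mkℚᵘ (+ k) 0)

toℚ-+ : ∀ m n → toℚ (m ℕ.+ n) ≡ toℚ m ℚ.+ toℚ n
toℚ-+ m n = ℚ.toℚᵘ-injective (begin
  ℚ.toℚᵘ (toℚ (m ℕ.+ n))                 ≈⟨ toℚᵘ-toℚ (m ℕ.+ n) ⟩
  ℚᵘ.mkℚᵘ (+ (m ℕ.+ n)) 0
    ≈⟨ ℚᵘ.*≡* (trans (cong (ℤ._* + 1) (ℤ.pos-+ m n)) (cross-multiplied (+ m) (+ n))) ⟩
  ℚᵘ.mkℚᵘ (+ m) 0 ℚᵘ.+ ℚᵘ.mkℚᵘ (+ n) 0    ≈⟨ ℚᵘ.+-cong (ℚᵘ.≃-sym (toℚᵘ-toℚ m)) (ℚᵘ.≃-sym (toℚᵘ-toℚ n)) ⟩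
  ℚ.toℚᵘ (toℚ m) ℚᵘ.+ ℚ.toℚᵘ (toℚ n)      ≈⟨ ℚᵘ.≃-sym (ℚ.toℚᵘ-homo-+ (toℚ m) (toℚ n)) ⟩
  ℚ.toℚᵘ (toℚ m ℚ.+ toℚ n)               ∎)
  where
  open ℚᵘ.≃-Reasoning
  cross-multiplied : ∀ x y → (x ℤ.+ y) ℤ.* + 1 ≡ (x ℤ.* + 1 ℤ.+ y ℤ.* + 1) ℤ.* + 1
  cross-multiplied = solve-∀

toℚ-* : ∀ m n → toℚ (m ℕ.* n) ≡ toℚ m ℚ.* toℚ n
toℚ-* m n = ℚ.toℚᵘ-injective (begin
  ℚ.toℚᵘ (toℚ (m ℕ.* n))                 ≈⟨ toℚᵘ-toℚ (m ℕ.* n) ⟩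
  ℚᵘ.mkℚᵘ (+ (m ℕ.* n)) 0                ≈⟨ ℚᵘ.*≡* (cong (ℤ._* + 1) (ℤ.pos-* m n)) ⟩
  ℚᵘ.mkℚᵘ (+ m) 0 ℚᵘ.* ℚᵘ.mkℚᵘ (+ n) 0    ≈⟨ ℚᵘ.*-cong (ℚᵘ.≃-sym (toℚᵘ-toℚ m)) (ℚᵘ.≃-sym (toℚᵘ-toℚ n)) ⟩
  ℚ.toℚᵘ (toℚ m) ℚᵘ.* ℚ.toℚᵘ (toℚ n)      ≈⟨ ℚᵘ.≃-sym (ℚ.toℚᵘ-homo-* (toℚ m) (toℚ n)) ⟩
  ℚ.toℚᵘ (toℚ m ℚ.* toℚ n)               ∎)
  where open ℚᵘ.≃-Reasoning

toℚ-injective : ∀ {m n} → toℚ m ≡ toℚ n → m ≡ n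
toℚ-injective {m} {n} eq with ℚᵘ.*≡* h ← ℚᵘ.≃-trans (ℚᵘ.≃-sym (toℚᵘ-toℚ m))
                                       (ℚᵘ.≃-trans (ℚ.toℚᵘ-cong eq) (toℚᵘ-toℚ n)) =
  ℤ.+-injective (trans (sym (ℤ.*-identityʳ (+ m))) (trans h (ℤ.*-identityʳ (+ n))))

toℚ-suc-pos : ∀ k → 0ℚ ℚ.< toℚ (suc k)
toℚ-suc-pos k = ℚ.toℚᵘ-cancel-<
  (ℚᵘ.<-respʳ-≃ (ℚᵘ.≃-sym (toℚᵘ-toℚ (suc k))) (ℚᵘ.positive⁻¹ (ℚᵘ.mkℚᵘ (+ suc k) 0)))

NonNeg : List ℚ → Set
NonNeg = All (0ℚ ℚ.≤_)

infixl 6 _+ₚ_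
infixl 7 _·ₚ_ _*ₚ_

_+ₚ_ : List ℚ → List ℚ → List ℚ
[]      +ₚ q       = q
(a ∷ p) +ₚ []      = a ∷ p
(a ∷ p) +ₚ (b ∷ q) = a ℚ.+ b ∷ p +ₚ q

_·ₚ_ : ℚ → List ℚ → List ℚ
c ·ₚ p = map (c ℚ.*_) p

-ₚ_ : List ℚ → List ℚ
-ₚ_ = map (ℚ.-_)

_*ₚ_ : List ℚ → List ℚ → List ℚ
[]      *ₚ q = []
(a ∷ p) *ₚ q = a ·ₚ q +ₚ (0ℚ ∷ p *ₚ q)

eval-+ₚ : ∀ p q x → eval (p +ₚ q) x ≡ eval p x ℚ.+ eval q x
eval-+ₚ []      q       x = sym (ℚ.+-identityˡ _)
eval-+ₚ (a ∷ p) []      x = sym (ℚ.+-identityʳ _)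
eval-+ₚ (a ∷ p) (b ∷ q) x = begin
  (a ℚ.+ b) ℚ.+ x ℚ.* eval (p +ₚ q) x               ≡⟨ cong (λ z → (a ℚ.+ b) ℚ.+ x ℚ.* z) (eval-+ₚ p q x) ⟩
  (a ℚ.+ b) ℚ.+ x ℚ.* (eval p x ℚ.+ eval q x)       ≡⟨ regroup a b x (eval p x) (eval q x) ⟩
  (a ℚ.+ x ℚ.* eval p x) ℚ.+ (b ℚ.+ x ℚ.* eval q x) ∎
  where
  open ≡-Reasoning
  regroup : ∀ a b x u v → (a ℚ.+ b) ℚ.+ x ℚ.* (u ℚ.+ v) ≡ (a ℚ.+ x ℚ.* u) ℚ.+ (b ℚ.+ x ℚ.* v)
  regroup = solve 5 (λ a b x u v → (a :+ b) :+ x :* (u :+ v) := (a :+ x :* u) :+ (b :+ x :* v)) refl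

eval-·ₚ : ∀ c p x → eval (c ·ₚ p) x ≡ c ℚ.* eval p x
eval-·ₚ c []      x = sym (ℚ.*-zeroʳ c)
eval-·ₚ c (a ∷ p) x = begin
  c ℚ.* a ℚ.+ x ℚ.* eval (c ·ₚ p) x   ≡⟨ cong (λ z → c ℚ.* a ℚ.+ x ℚ.* z) (eval-·ₚ c p x) ⟩
  c ℚ.* a ℚ.+ x ℚ.* (c ℚ.* eval p x)  ≡⟨ factor c a x (eval p x) ⟩
  c ℚ.* (a ℚ.+ x ℚ.* eval p x)        ∎
  where
  open ≡-Reasoning
  factor : ∀ c a x u → c ℚ.* a ℚ.+ x ℚ.* (c ℚ.* u) ≡ c ℚ.* (a ℚ.+ x ℚ.* u)
  factor = solve 4 (λ c a x u → c :* a :+ x :* (c :* u) := c :* (a :+ x :* u)) refl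

eval-negₚ : ∀ p x → eval (-ₚ p) x ≡ ℚ.- eval p x
eval-negₚ []      x = refl
eval-negₚ (a ∷ p) x = begin
  ℚ.- a ℚ.+ x ℚ.* eval (-ₚ p) x     ≡⟨ cong (λ z → ℚ.- a ℚ.+ x ℚ.* z) (eval-negₚ p x) ⟩
  ℚ.- a ℚ.+ x ℚ.* ℚ.- eval p x      ≡⟨ negate-out a x (eval p x) ⟩
  ℚ.- (a ℚ.+ x ℚ.* eval p x)        ∎
  where
  open ≡-Reasoning
  negate-out : ∀ a x u → ℚ.- a ℚ.+ x ℚ.* ℚ.- u ≡ ℚ.- (a ℚ.+ x ℚ.* u)
  negate-out = solve 3 (λ a x u → :- a :+ x :* (:- u) := :- (a :+ x :* u)) refl

eval-*ₚ : ∀ p q x → eval (p *ₚ q) x ≡ eval p x ℚ.* eval q x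
eval-*ₚ []      q x = sym (ℚ.*-zeroˡ (eval q x))
eval-*ₚ (a ∷ p) q x = begin
  eval (a ·ₚ q +ₚ (0ℚ ∷ p *ₚ q)) x                 ≡⟨ eval-+ₚ (a ·ₚ q) (0ℚ ∷ p *ₚ q) x ⟩
  eval (a ·ₚ q) x ℚ.+ (0ℚ ℚ.+ x ℚ.* eval (p *ₚ q) x) ≡⟨ cong₂ ℚ._+_ (eval-·ₚ a q x) (ℚ.+-identityˡ _) ⟩
  a ℚ.* eval q x ℚ.+ x ℚ.* eval (p *ₚ q) x         ≡⟨ cong (λ z → a ℚ.* eval q x ℚ.+ x ℚ.* z) (eval-*ₚ p q x) ⟩
  a ℚ.* eval q x ℚ.+ x ℚ.* (eval p x ℚ.* eval q x)  ≡⟨ factor a x (eval p x) (eval q x) ⟩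
  (a ℚ.+ x ℚ.* eval p x) ℚ.* eval q x              ∎
  where
  open ≡-Reasoning
  factor : ∀ a x u v → a ℚ.* v ℚ.+ x ℚ.* (u ℚ.* v) ≡ (a ℚ.+ x ℚ.* u) ℚ.* v
  factor = solve 4 (λ a x u v → a :* v :+ x :* (u :* v) := (a :+ x :* u) :* v) refl

coeff-+ₚ : ∀ p q i → coeff (p +ₚ q) i ≡ coeff p i ℚ.+ coeff q i
coeff-+ₚ []      q       i       = sym (ℚ.+-identityˡ _)
coeff-+ₚ (a ∷ p) []      i       = sym (ℚ.+-identityʳ _)
coeff-+ₚ (a ∷ p) (b ∷ q) zero    = refl
coeff-+ₚ (a ∷ p) (b ∷ q) (suc i) = coeff-+ₚ p q i

coeff-·ₚ : ∀ c p i → coeff (c ·ₚ p) i ≡ c ℚ.* coeff p i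
coeff-·ₚ c []      i       = sym (ℚ.*-zeroʳ c)
coeff-·ₚ c (a ∷ p) zero    = refl
coeff-·ₚ c (a ∷ p) (suc i) = coeff-·ₚ c p i

coeff-negₚ : ∀ p i → coeff (-ₚ p) i ≡ ℚ.- coeff p i
coeff-negₚ []      i       = refl
coeff-negₚ (a ∷ p) zero    = refl
coeff-negₚ (a ∷ p) (suc i) = coeff-negₚ p i

coeff-*ₚ-const : ∀ p e i → coeff (p *ₚ (e ∷ [])) i ≡ coeff p i ℚ.* e
coeff-*ₚ-const []      e i       = sym (ℚ.*-zeroˡ e)
coeff-*ₚ-const (a ∷ p) e zero    = ℚ.+-identityʳ (a ℚ.* e)
coeff-*ₚ-const (a ∷ p) e (suc i) = coeff-*ₚ-const p e i

coeff-nonNeg : ∀ {p} → NonNeg p → ∀ i → 0ℚ ℚ.≤ coeff p i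
coeff-nonNeg []       i       = ℚ.≤-refl
coeff-nonNeg (a ∷ as) zero    = a
coeff-nonNeg (a ∷ as) (suc i) = coeff-nonNeg as i

nonNeg-coeff : ∀ p → (∀ i → 0ℚ ℚ.≤ coeff p i) → NonNeg p
nonNeg-coeff []      h = []
nonNeg-coeff (a ∷ p) h = h zero ∷ nonNeg-coeff p (h ∘ suc)

+-nonNeg : ∀ {a b} → 0ℚ ℚ.≤ a → 0ℚ ℚ.≤ b → 0ℚ ℚ.≤ a ℚ.+ b
+-nonNeg a≥0 b≥0 = ℚ.+-mono-≤ a≥0 b≥0

*-nonNeg : ∀ {a b} → 0ℚ ℚ.≤ a → 0ℚ ℚ.≤ b → 0ℚ ℚ.≤ a ℚ.* b
*-nonNeg {a} {b} a≥0 b≥0 =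
  subst (ℚ._≤ a ℚ.* b) (ℚ.*-zeroʳ a) (ℚ.*-monoˡ-≤-nonNeg a {{ℚ.nonNegative a≥0}} b≥0)

+ₚ-nonNeg : ∀ {p q} → NonNeg p → NonNeg q → NonNeg (p +ₚ q)
+ₚ-nonNeg {[]}                []       q≥0      = q≥0
+ₚ-nonNeg {_ ∷ _} {[]}        p≥0      []       = p≥0
+ₚ-nonNeg {_ ∷ _} {_ ∷ _}     (a ∷ p)  (b ∷ q)  = +-nonNeg a b ∷ +ₚ-nonNeg p q

·ₚ-nonNeg : ∀ {c p} → 0ℚ ℚ.≤ c → NonNeg p → NonNeg (c ·ₚ p)
·ₚ-nonNeg c≥0 []      = []
·ₚ-nonNeg c≥0 (a ∷ p) = *-nonNeg c≥0 a ∷ ·ₚ-nonNeg c≥0 p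

*ₚ-nonNeg : ∀ {p q} → NonNeg p → NonNeg q → NonNeg (p *ₚ q)
*ₚ-nonNeg []      q≥0 = []
*ₚ-nonNeg (a ∷ p) q≥0 = +ₚ-nonNeg (·ₚ-nonNeg a q≥0) (ℚ.≤-refl ∷ *ₚ-nonNeg p q≥0)

-- For p = c ∷ q:  p (x + y) = c + (x + y) · q (x + y).
shift : ℚ → List ℚ → List ℚ
shift x []       = []
shift x (c ∷ cs) = (c ∷ []) +ₚ (x ·ₚ shift x cs +ₚ (0ℚ ∷ shift x cs))

derivative : List ℚ → List ℚ
derivative []       = []
derivative (c ∷ cs) = cs +ₚ (0ℚ ∷ derivative cs)

eval-shift : ∀ p x y → eval (shift x p) y ≡ eval p (x ℚ.+ y)
eval-shift []       x y = refl
eval-shift (c ∷ cs) x y = begin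
  eval ((c ∷ []) +ₚ (x ·ₚ S +ₚ (0ℚ ∷ S))) y
    ≡⟨ eval-+ₚ (c ∷ []) (x ·ₚ S +ₚ (0ℚ ∷ S)) y ⟩
  eval (c ∷ []) y ℚ.+ eval (x ·ₚ S +ₚ (0ℚ ∷ S)) y
    ≡⟨ cong₂ ℚ._+_ (eval-const c y) (eval-+ₚ (x ·ₚ S) (0ℚ ∷ S) y) ⟩
  c ℚ.+ (eval (x ·ₚ S) y ℚ.+ (0ℚ ℚ.+ y ℚ.* eval S y))
    ≡⟨ cong (λ z → c ℚ.+ (z ℚ.+ (0ℚ ℚ.+ y ℚ.* eval S y))) (eval-·ₚ x S y) ⟩
  c ℚ.+ (x ℚ.* eval S y ℚ.+ (0ℚ ℚ.+ y ℚ.* eval S y))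
    ≡⟨ collect c x y (eval S y) ⟩
  c ℚ.+ (x ℚ.+ y) ℚ.* eval S y
    ≡⟨ cong (λ z → c ℚ.+ (x ℚ.+ y) ℚ.* z) (eval-shift cs x y) ⟩
  c ℚ.+ (x ℚ.+ y) ℚ.* eval cs (x ℚ.+ y) ∎
  where
  open ≡-Reasoning
  S = shift x cs
  eval-const : ∀ c y → eval (c ∷ []) y ≡ c
  eval-const c y = trans (cong (c ℚ.+_) (ℚ.*-zeroʳ y)) (ℚ.+-identityʳ c)
  collect : ∀ c x y s → c ℚ.+ (x ℚ.* s ℚ.+ (0ℚ ℚ.+ y ℚ.* s)) ≡ c ℚ.+ (x ℚ.+ y) ℚ.* s
  collect = solve 4 (λ c x y s → c :+ (x :* s :+ (con 0ℚ :+ y :* s)) := c :+ (x :+ y) :* s) refl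

coeff₀-shift : ∀ p x → coeff (shift x p) 0 ≡ eval p x
coeff₀-shift []       x = refl
coeff₀-shift (c ∷ cs) x = begin
  coeff ((c ∷ []) +ₚ (x ·ₚ S +ₚ (0ℚ ∷ S))) 0   ≡⟨ coeff-+ₚ (c ∷ []) (x ·ₚ S +ₚ (0ℚ ∷ S)) 0 ⟩
  c ℚ.+ coeff (x ·ₚ S +ₚ (0ℚ ∷ S)) 0          ≡⟨ cong (c ℚ.+_) (coeff-+ₚ (x ·ₚ S) (0ℚ ∷ S) 0) ⟩
  c ℚ.+ (coeff (x ·ₚ S) 0 ℚ.+ 0ℚ)             ≡⟨ cong (c ℚ.+_) (ℚ.+-identityʳ _) ⟩
  c ℚ.+ coeff (x ·ₚ S) 0                      ≡⟨ cong (c ℚ.+_) (coeff-·ₚ x S 0) ⟩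
  c ℚ.+ x ℚ.* coeff S 0                       ≡⟨ cong (λ z → c ℚ.+ x ℚ.* z) (coeff₀-shift cs x) ⟩
  c ℚ.+ x ℚ.* eval cs x                       ∎
  where
  open ≡-Reasoning
  S = shift x cs

coeff₁-shift : ∀ p x → coeff (shift x p) 1 ≡ eval (derivative p) x
coeff₁-shift []       x = refl
coeff₁-shift (c ∷ cs) x = begin
  coeff ((c ∷ []) +ₚ (x ·ₚ S +ₚ (0ℚ ∷ S))) 1       ≡⟨ coeff-+ₚ (c ∷ []) (x ·ₚ S +ₚ (0ℚ ∷ S)) 1 ⟩
  0ℚ ℚ.+ coeff (x ·ₚ S +ₚ (0ℚ ∷ S)) 1              ≡⟨ ℚ.+-identityˡ _ ⟩
  coeff (x ·ₚ S +ₚ (0ℚ ∷ S)) 1                     ≡⟨ coeff-+ₚ (x ·ₚ S) (0ℚ ∷ S) 1 ⟩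
  coeff (x ·ₚ S) 1 ℚ.+ coeff S 0                   ≡⟨ cong₂ ℚ._+_ (coeff-·ₚ x S 1) (coeff₀-shift cs x) ⟩
  x ℚ.* coeff S 1 ℚ.+ eval cs x                    ≡⟨ cong (λ z → x ℚ.* z ℚ.+ eval cs x) (coeff₁-shift cs x) ⟩
  x ℚ.* eval (derivative cs) x ℚ.+ eval cs x        ≡⟨ ℚ.+-comm _ (eval cs x) ⟩
  eval cs x ℚ.+ x ℚ.* eval (derivative cs) x        ≡⟨ cong (eval cs x ℚ.+_) (ℚ.+-identityˡ _) ⟨
  eval cs x ℚ.+ eval (0ℚ ∷ derivative cs) x         ≡⟨ eval-+ₚ cs (0ℚ ∷ derivative cs) x ⟨
  eval (derivative (c ∷ cs)) x                      ∎
  where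
  open ≡-Reasoning
  S = shift x cs

coeff-derivative : ∀ p i → coeff (derivative p) i ≡ toℚ (suc i) ℚ.* coeff p (suc i)
coeff-derivative []       i       = sym (ℚ.*-zeroʳ (toℚ (suc i)))
coeff-derivative (c ∷ cs) zero    = begin
  coeff (cs +ₚ (0ℚ ∷ derivative cs)) 0  ≡⟨ coeff-+ₚ cs (0ℚ ∷ derivative cs) 0 ⟩
  coeff cs 0 ℚ.+ 0ℚ                    ≡⟨ ℚ.+-identityʳ _ ⟩
  coeff cs 0                           ≡⟨ ℚ.*-identityˡ _ ⟨
  1ℚ ℚ.* coeff cs 0                    ∎
  where open ≡-Reasoning
coeff-derivative (c ∷ cs) (suc i) = begin
  coeff (cs +ₚ (0ℚ ∷ derivative cs)) (suc i)           ≡⟨ coeff-+ₚ cs (0ℚ ∷ derivative cs) (suc i) ⟩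
  coeff cs (suc i) ℚ.+ coeff (derivative cs) i         ≡⟨ cong (coeff cs (suc i) ℚ.+_) (coeff-derivative cs i) ⟩
  coeff cs (suc i) ℚ.+ toℚ (suc i) ℚ.* coeff cs (suc i) ≡⟨ collect (toℚ (suc i)) (coeff cs (suc i)) ⟩
  (toℚ 1 ℚ.+ toℚ (suc i)) ℚ.* coeff cs (suc i)          ≡⟨ cong (ℚ._* coeff cs (suc i)) (toℚ-+ 1 (suc i)) ⟨
  toℚ (suc (suc i)) ℚ.* coeff cs (suc i)                ∎
  where
  open ≡-Reasoning
  collect : ∀ t a → a ℚ.+ t ℚ.* a ≡ (1ℚ ℚ.+ t) ℚ.* a
  collect = solve 2 (λ t a → a :+ t :* a := (con 1ℚ :+ t) :* a) refl

-- Uniqueness of polynomial representations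

IsZero : List ℚ → Set
IsZero p = ∀ i → coeff p i ≡ 0ℚ

divLinear : ℚ → List ℚ → List ℚ × ℚ
divLinear a []           = [] , 0ℚ
divLinear a (c ∷ [])     = [] , c
divLinear a (c ∷ d ∷ cs) = let q , r = divLinear a (d ∷ cs) in r ∷ q , c ℚ.+ a ℚ.* r

eval-divLinear : ∀ a p x → let q , r = divLinear a p in eval p x ≡ (x ℚ.- a) ℚ.* eval q x ℚ.+ r
eval-divLinear a []           x = sym (trans (ℚ.+-identityʳ _) (ℚ.*-zeroʳ (x ℚ.- a)))
eval-divLinear a (c ∷ [])     x = trans (c+x*0≡c c x) (sym (x*0+c≡c c (x ℚ.- a)))
  where
  c+x*0≡c : ∀ c x → c ℚ.+ x ℚ.* 0ℚ ≡ c
  c+x*0≡c = solve 2 (λ c x → c :+ x :* con 0ℚ := c) refl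
  x*0+c≡c : ∀ c x → x ℚ.* 0ℚ ℚ.+ c ≡ c
  x*0+c≡c = solve 2 (λ c x → x :* con 0ℚ :+ c := c) refl
eval-divLinear a (c ∷ d ∷ cs) x = begin
  c ℚ.+ x ℚ.* eval (d ∷ cs) x                       ≡⟨ cong (λ z → c ℚ.+ x ℚ.* z) (eval-divLinear a (d ∷ cs) x) ⟩
  c ℚ.+ x ℚ.* ((x ℚ.- a) ℚ.* eval q x ℚ.+ r)         ≡⟨ regroup a c x (eval q x) r ⟩
  (x ℚ.- a) ℚ.* (r ℚ.+ x ℚ.* eval q x) ℚ.+ (c ℚ.+ a ℚ.* r) ∎
  where
  open ≡-Reasoning
  q = proj₁ (divLinear a (d ∷ cs))
  r = proj₂ (divLinear a (d ∷ cs))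
  regroup : ∀ a c x u r → c ℚ.+ x ℚ.* ((x ℚ.- a) ℚ.* u ℚ.+ r) ≡ (x ℚ.- a) ℚ.* (r ℚ.+ x ℚ.* u) ℚ.+ (c ℚ.+ a ℚ.* r)
  regroup = solve 5 (λ a c x u r → c :+ x :* ((x :+ :- a) :* u :+ r)
                                 := (x :+ :- a) :* (r :+ x :* u) :+ (c :+ a :* r)) refl

divLinear-isZero : ∀ a p → let q , r = divLinear a p in IsZero q → r ≡ 0ℚ → IsZero p
divLinear-isZero a []           q≡0 r≡0 i             = refl
divLinear-isZero a (c ∷ [])     q≡0 r≡0 zero          = r≡0
divLinear-isZero a (c ∷ [])     q≡0 r≡0 (suc i)       = refl
divLinear-isZero a (c ∷ d ∷ cs) q≡0 r≡0 zero          = begin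
  c                                      ≡⟨ c+a*0≡c c a ⟨
  c ℚ.+ a ℚ.* 0ℚ                          ≡⟨ cong (λ z → c ℚ.+ a ℚ.* z) (q≡0 zero) ⟨
  c ℚ.+ a ℚ.* proj₂ (divLinear a (d ∷ cs)) ≡⟨ r≡0 ⟩
  0ℚ                                     ∎
  where
  open ≡-Reasoning
  c+a*0≡c : ∀ c a → c ℚ.+ a ℚ.* 0ℚ ≡ c
  c+a*0≡c = solve 2 (λ c a → c :+ a :* con 0ℚ := c) refl
divLinear-isZero a (c ∷ d ∷ cs) q≡0 r≡0 (suc i) = divLinear-isZero a (d ∷ cs) (q≡0 ∘ suc) (q≡0 zero) i

length-divLinear : ∀ a c cs → length (proj₁ (divLinear a (c ∷ cs))) ≡ length cs
length-divLinear a c []       = refl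
length-divLinear a c (d ∷ cs) = cong suc (length-divLinear a d cs)

*-zero-cancelˡ : ∀ x y → x ≢ 0ℚ → x ℚ.* y ≡ 0ℚ → y ≡ 0ℚ
*-zero-cancelˡ x y x≢0 xy≡0 = begin
  y                   ≡⟨ ℚ.*-identityˡ y ⟨
  1ℚ ℚ.* y            ≡⟨ cong (ℚ._* y) (ℚ.*-inverseˡ x) ⟨
  (x⁻¹ ℚ.* x) ℚ.* y   ≡⟨ ℚ.*-assoc x⁻¹ x y ⟩
  x⁻¹ ℚ.* (x ℚ.* y)   ≡⟨ cong (x⁻¹ ℚ.*_) xy≡0 ⟩
  x⁻¹ ℚ.* 0ℚ          ≡⟨ ℚ.*-zeroʳ x⁻¹ ⟩
  0ℚ                  ∎
  where
  open ≡-Reasoning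
  instance _ = ℚ.≢-nonZero x≢0
  x⁻¹ = ℚ.1/ x

x≢a⇒x-a≢0 : ∀ x a → x ≢ a → x ℚ.- a ≢ 0ℚ
x≢a⇒x-a≢0 x a x≢a x-a≡0 = x≢a (begin
  x                  ≡⟨ [x-a]+a≡x x a ⟨
  (x ℚ.- a) ℚ.+ a    ≡⟨ cong (ℚ._+ a) x-a≡0 ⟩
  0ℚ ℚ.+ a           ≡⟨ ℚ.+-identityˡ a ⟩
  a                  ∎)
  where
  open ≡-Reasoning
  [x-a]+a≡x : ∀ x a → (x ℚ.- a) ℚ.+ a ≡ x
  [x-a]+a≡x = solve 2 (λ x a → (x :+ :- a) :+ a := x) refl

-- A polynomial with a root at every n ≥ m is zero: the remainder modulo (x - m) vanishes,
-- and the quotient again has a root at every n > m.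
eventuallyZero⇒isZero : ∀ L p → length p ℕ.≤ L → ∀ m →
                        (∀ n → m ℕ.≤ n → eval p (toℚ n) ≡ 0ℚ) → IsZero p
eventuallyZero⇒isZero L       []       _            m roots i = refl
eventuallyZero⇒isZero (suc L) (c ∷ cs) (s≤s len≤L) m roots =
  divLinear-isZero a (c ∷ cs) q≡0 r≡0
  where
  a = toℚ m
  q = proj₁ (divLinear a (c ∷ cs))
  r = proj₂ (divLinear a (c ∷ cs))
  r≡0 : r ≡ 0ℚ
  r≡0 = begin
    r                                 ≡⟨ [a-a]*u+r≡r (eval q a) r a ⟨
    (a ℚ.- a) ℚ.* eval q a ℚ.+ r       ≡⟨ eval-divLinear a (c ∷ cs) a ⟨
    eval (c ∷ cs) a                   ≡⟨ roots m ℕ.≤-refl ⟩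
    0ℚ                                ∎
    where
    open ≡-Reasoning
    [a-a]*u+r≡r : ∀ u r a → (a ℚ.- a) ℚ.* u ℚ.+ r ≡ r
    [a-a]*u+r≡r = solve 3 (λ u r a → (a :+ :- a) :* u :+ r := r) refl
  q-roots : ∀ n → suc m ℕ.≤ n → eval q (toℚ n) ≡ 0ℚ
  q-roots n m<n = *-zero-cancelˡ (toℚ n ℚ.- a) (eval q (toℚ n))
    (x≢a⇒x-a≢0 (toℚ n) a (λ eq → ℕ.<⇒≢ m<n (sym (toℚ-injective eq)))) (begin
      (toℚ n ℚ.- a) ℚ.* eval q (toℚ n)          ≡⟨ ℚ.+-identityʳ _ ⟨
      (toℚ n ℚ.- a) ℚ.* eval q (toℚ n) ℚ.+ 0ℚ    ≡⟨ cong ((toℚ n ℚ.- a) ℚ.* eval q (toℚ n) ℚ.+_) r≡0 ⟨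
      (toℚ n ℚ.- a) ℚ.* eval q (toℚ n) ℚ.+ r     ≡⟨ eval-divLinear a (c ∷ cs) (toℚ n) ⟨
      eval (c ∷ cs) (toℚ n)                     ≡⟨ roots n (ℕ.<⇒≤ m<n) ⟩
      0ℚ                                        ∎)
    where open ≡-Reasoning
  q≡0 : IsZero q
  q≡0 = eventuallyZero⇒isZero L q (subst (ℕ._≤ L) (sym (length-divLinear a c cs)) len≤L) (suc m) q-roots

coeff-unique : ∀ p q → (∀ n → 1 ℕ.≤ n → eval p (toℚ n) ≡ eval q (toℚ n)) →
               ∀ i → coeff p i ≡ coeff q i
coeff-unique p q agree i = begin
  coeff p i                            ≡⟨ [a-b]+b≡a (coeff p i) (coeff q i) ⟨
  (coeff p i ℚ.- coeff q i) ℚ.+ coeff q i ≡⟨ cong (ℚ._+ coeff q i) (cong (coeff p i ℚ.+_) (coeff-negₚ q i)) ⟨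
  (coeff p i ℚ.+ coeff (-ₚ q) i) ℚ.+ coeff q i ≡⟨ cong (ℚ._+ coeff q i) (coeff-+ₚ p (-ₚ q) i) ⟨
  coeff (p +ₚ -ₚ q) i ℚ.+ coeff q i     ≡⟨ cong (ℚ._+ coeff q i) (difference≡0 i) ⟩
  0ℚ ℚ.+ coeff q i                     ≡⟨ ℚ.+-identityˡ _ ⟩
  coeff q i                            ∎
  where
  open ≡-Reasoning
  [a-b]+b≡a : ∀ a b → (a ℚ.- b) ℚ.+ b ≡ a
  [a-b]+b≡a = solve 2 (λ a b → (a :+ :- b) :+ b := a) refl
  difference≡0 : IsZero (p +ₚ -ₚ q)
  difference≡0 = eventuallyZero⇒isZero _ (p +ₚ -ₚ q) ℕ.≤-refl 1 λ n n≥1 → begin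
    eval (p +ₚ -ₚ q) (toℚ n)                  ≡⟨ eval-+ₚ p (-ₚ q) (toℚ n) ⟩
    eval p (toℚ n) ℚ.+ eval (-ₚ q) (toℚ n)    ≡⟨ cong₂ ℚ._+_ (agree n n≥1) (eval-negₚ q (toℚ n)) ⟩
    eval q (toℚ n) ℚ.- eval q (toℚ n)         ≡⟨ ℚ.+-inverseʳ (eval q (toℚ n)) ⟩
    0ℚ                                        ∎

module _ {X Y : Set} {P : X → Set} {Q : Y → Set} where

  Card-image : ∀ {k} (h : X → Y) → (∀ {x x′} → h x ≡ h x′ → x ≡ x′) → Card X P k →
               (∀ x → P x → Q (h x)) → (∀ y → Q y → ∃ λ x → P x × h x ≡ y) → Card Y Q k
  Card-image h h-inj (f , f-inj , f-P , f-onto) P⇒Q Q⇒P =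
    h ∘ f , f-inj ∘ h-inj , (λ i → P⇒Q _ (f-P i)) , onto
    where
    onto : ∀ y → Q y → ∃ λ i → h (f i) ≡ y
    onto y qy = let x , px , hx≡y = Q⇒P y qy ; i , fi≡x = f-onto x px in i , trans (cong h fi≡x) hx≡y

  Card-× : ∀ {k l} → Card X P k → Card Y Q l → Card (X × Y) (λ (x , y) → P x × Q y) (k ℕ.* l)
  Card-× {k} {l} (f , f-inj , f-P , f-onto) (g , g-inj , g-Q , g-onto) =
    fg ∘ Fin.remQuot l , fg∘remQuot-inj , (λ c → f-P _ , g-Q _) , onto
    where
    fg : Fin k × Fin l → X × Y
    fg (i , j) = f i , g j
    fg∘remQuot-inj : Injective _≡_ _≡_ (fg ∘ Fin.remQuot l)
    fg∘remQuot-inj {c} {d} eq = begin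
      c                                   ≡⟨ Fin.combine-remQuot {k} l c ⟨
      uncurry Fin.combine (Fin.remQuot {k} l c)
        ≡⟨ cong (uncurry Fin.combine) (cong₂ _,_ (f-inj (cong proj₁ eq)) (g-inj (cong proj₂ eq))) ⟩
      uncurry Fin.combine (Fin.remQuot {k} l d) ≡⟨ Fin.combine-remQuot {k} l d ⟩
      d                                   ∎
      where open ≡-Reasoning
    onto : ∀ z → P (proj₁ z) × Q (proj₂ z) → ∃ λ c → fg (Fin.remQuot l c) ≡ z
    onto (x , y) (px , qy) with i , fi≡x ← f-onto x px | j , gj≡y ← g-onto y qy =
      Fin.combine i j , trans (cong fg (Fin.remQuot-combine i j)) (cong₂ _,_ fi≡x gj≡y)

module _ {X : Set} {P Q : X → Set} where

  Card-resp : ∀ {k} → Card X P k → (∀ x → P x → Q x) → (∀ x → Q x → P x) → Card X Q k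
  Card-resp c P⇒Q Q⇒P = Card-image id id c P⇒Q (λ x qx → x , Q⇒P x qx , refl)

  Card-⊎ : ∀ {k l} → Card X P k → Card X Q l → (∀ x → P x → ¬ Q x) →
           Card X (λ x → P x ⊎ Q x) (k ℕ.+ l)
  Card-⊎ {k} {l} (f , f-inj , f-P , f-onto) (g , g-inj , g-Q , g-onto) disjoint =
    [f,g] ∘ Fin.splitAt k , inj , in-P⊎Q , onto
    where
    [f,g] : Fin k ⊎ Fin l → X
    [f,g] (inj₁ i) = f i
    [f,g] (inj₂ j) = g j
    [f,g]-inj : ∀ u v → [f,g] u ≡ [f,g] v → u ≡ v
    [f,g]-inj (inj₁ i) (inj₁ j) eq = cong inj₁ (f-inj eq)
    [f,g]-inj (inj₂ i) (inj₂ j) eq = cong inj₂ (g-inj eq)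
    [f,g]-inj (inj₁ i) (inj₂ j) eq = ⊥-elim (disjoint (f i) (f-P i) (subst Q (sym eq) (g-Q j)))
    [f,g]-inj (inj₂ i) (inj₁ j) eq = ⊥-elim (disjoint (f j) (f-P j) (subst Q eq (g-Q i)))
    inj : Injective _≡_ _≡_ ([f,g] ∘ Fin.splitAt k)
    inj {c} {d} eq = begin
      c                            ≡⟨ Fin.join-splitAt k l c ⟨
      Fin.join k l (Fin.splitAt k c) ≡⟨ cong (Fin.join k l) ([f,g]-inj (Fin.splitAt k c) (Fin.splitAt k d) eq) ⟩
      Fin.join k l (Fin.splitAt k d) ≡⟨ Fin.join-splitAt k l d ⟩
      d                            ∎
      where open ≡-Reasoning
    in-P⊎Q : ∀ c → P ([f,g] (Fin.splitAt k c)) ⊎ Q ([f,g] (Fin.splitAt k c))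
    in-P⊎Q c with Fin.splitAt k c
    ... | inj₁ i = inj₁ (f-P i)
    ... | inj₂ j = inj₂ (g-Q j)
    onto : ∀ x → P x ⊎ Q x → ∃ λ c → [f,g] (Fin.splitAt k c) ≡ x
    onto x (inj₁ px) with i , fi≡x ← f-onto x px =
      Fin.join k l (inj₁ i) , trans (cong [f,g] (Fin.splitAt-join k l (inj₁ i))) fi≡x
    onto x (inj₂ qx) with j , gj≡x ← g-onto x qx =
      Fin.join k l (inj₂ j) , trans (cong [f,g] (Fin.splitAt-join k l (inj₂ j))) gj≡x

module _ {X : Set} {P : X → Set} where

  Card-∅ : (∀ x → ¬ P x) → Card X P 0
  Card-∅ ¬P = (λ ()) , (λ {i} → contradiction i λ ()) , (λ ()) , λ x px → contradiction px (¬P x)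

  Card-unique : ∀ {k l} → Card X P k → Card X P l → k ≡ l
  Card-unique c d = ℕ.≤-antisym (Card-≤ c d) (Card-≤ d c)
    where
    Card-≤ : ∀ {k l} → Card X P k → Card X P l → k ℕ.≤ l
    Card-≤ {k} {l} (f , f-inj , f-P , _) (g , _ , _ , g-onto) = Fin.injective⇒≤ {f = index} index-inj
      where
      index : Fin k → Fin l
      index i = proj₁ (g-onto (f i) (f-P i))
      index-inj : Injective _≡_ _≡_ index
      index-inj {i} {j} eq = f-inj (begin
        f i                ≡⟨ proj₂ (g-onto (f i) (f-P i)) ⟨
        g (index i)        ≡⟨ cong g eq ⟩
        g (index j)        ≡⟨ proj₂ (g-onto (f j) (f-P j)) ⟩
        f j                ∎)
        where open ≡-Reasoning

Card-singleton : ∀ {X : Set} (x₀ : X) → Card X (_≡ x₀) 1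
Card-singleton x₀ = (λ _ → x₀) , (λ { {zero} {zero} _ → refl }) , (λ _ → refl) , λ x x≡x₀ → zero , sym x≡x₀

module _ {A : Set} (_∙_ : A → A → A) where

  foldSubsets : ∀ n → (Subset n → A) → A
  foldSubsets zero    f = f []
  foldSubsets (suc n) f = foldSubsets n (f ∘ (inside ∷_)) ∙ foldSubsets n (f ∘ (outside ∷_))

  foldSubsets-cong : ∀ n {f g : Subset n → A} → (∀ U → f U ≡ g U) → foldSubsets n f ≡ foldSubsets n g
  foldSubsets-cong zero    f≗g = f≗g []
  foldSubsets-cong (suc n) f≗g =
    cong₂ _∙_ (foldSubsets-cong n (f≗g ∘ (inside ∷_))) (foldSubsets-cong n (f≗g ∘ (outside ∷_)))

  foldSubsets-preserves : (P : A → Set) → (∀ {x y} → P x → P y → P (x ∙ y)) →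
                          ∀ n {f} → (∀ U → P (f U)) → P (foldSubsets n f)
  foldSubsets-preserves P P-∙ zero    Pf = Pf []
  foldSubsets-preserves P P-∙ (suc n) Pf =
    P-∙ (foldSubsets-preserves P P-∙ n (Pf ∘ (inside ∷_))) (foldSubsets-preserves P P-∙ n (Pf ∘ (outside ∷_)))

foldSubsets-homo : ∀ {A B : Set} {_∙_ : A → A → A} {_∘′_ : B → B → B} (h : A → B) →
                   (∀ x y → h (x ∙ y) ≡ h x ∘′ h y) →
                   ∀ n f → h (foldSubsets _∙_ n f) ≡ foldSubsets _∘′_ n (h ∘ f)
foldSubsets-homo h homo zero    f = refl
foldSubsets-homo {_∙_ = _∙_} {_∘′_} h homo (suc n) f =
  trans (homo (foldSubsets _∙_ n (f ∘ (inside ∷_))) (foldSubsets _∙_ n (f ∘ (outside ∷_))))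
        (cong₂ _∘′_ (foldSubsets-homo h homo n (f ∘ (inside ∷_))) (foldSubsets-homo h homo n (f ∘ (outside ∷_))))

foldSubsets-zero : ∀ n (f : Subset n → ℚ) → (∀ U → f U ≡ 0ℚ) → foldSubsets ℚ._+_ n f ≡ 0ℚ
foldSubsets-zero n f f≡0 =
  foldSubsets-preserves ℚ._+_ (_≡ 0ℚ) (λ x≡0 y≡0 → trans (cong₂ ℚ._+_ x≡0 y≡0) (ℚ.+-identityˡ 0ℚ)) n f≡0

foldSubsets-single : ∀ n (f : Subset n → ℚ) V → (∀ U → U ≢ V → f U ≡ 0ℚ) → foldSubsets ℚ._+_ n f ≡ f V
foldSubsets-single zero    f []            _     = refl
foldSubsets-single (suc n) f (inside  ∷ V) f≡0 = trans
  (cong₂ ℚ._+_ (foldSubsets-single n _ V λ U U≢V → f≡0 _ (U≢V ∘ Vec.∷-injectiveʳ))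
               (foldSubsets-zero n _ λ U → f≡0 _ λ ()))
  (ℚ.+-identityʳ _)
foldSubsets-single (suc n) f (outside ∷ V) f≡0 = trans
  (cong₂ ℚ._+_ (foldSubsets-zero n _ λ U → f≡0 _ λ ())
               (foldSubsets-single n _ V λ U U≢V → f≡0 _ (U≢V ∘ Vec.∷-injectiveʳ)))
  (ℚ.+-identityˡ _)

foldSubsets-⊤⊥ : ∀ n (f : Subset n → ℚ) → n ≢ 0 → (∀ U → U ≢ ⊤ → U ≢ ⊥ → f U ≡ 0ℚ) →
                 foldSubsets ℚ._+_ n f ≡ f ⊤ ℚ.+ f ⊥
foldSubsets-⊤⊥ zero    f n≢0 f≡0 = contradiction refl n≢0
foldSubsets-⊤⊥ (suc n) f n≢0 f≡0 = cong₂ ℚ._+_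
  (foldSubsets-single n _ ⊤ λ U U≢⊤ → f≡0 _ (U≢⊤ ∘ Vec.∷-injectiveʳ) λ ())
  (foldSubsets-single n _ ⊥ λ U U≢⊥ → f≡0 _ (λ ()) (U≢⊥ ∘ Vec.∷-injectiveʳ))

Card-⋃ : ∀ {X : Set} n (P : Subset n → X → Set) (k : Subset n → ℕ) →
         (∀ U → Card X (P U) (k U)) → (∀ U V x → P U x → P V x → U ≡ V) →
         Card X (λ x → ∃ λ U → P U x) (foldSubsets ℕ._+_ n k)
Card-⋃ zero    P k card disjoint = Card-resp (card []) (λ x p → [] , p) (λ { x ([] , p) → p })
Card-⋃ (suc n) P k card disjoint = Card-resp (Card-⊎ (⋃ inside) (⋃ outside) different) into from
  where
  ⋃ : ∀ b → Card _ (λ x → ∃ λ U → P (b ∷ U) x) (foldSubsets ℕ._+_ n (k ∘ (b ∷_)))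
  ⋃ b = Card-⋃ n (P ∘ (b ∷_)) (k ∘ (b ∷_)) (card ∘ (b ∷_))
                 (λ U V x pU pV → Vec.∷-injectiveʳ (disjoint _ _ x pU pV))
  different : ∀ x → (∃ λ U → P (inside ∷ U) x) → ¬ (∃ λ V → P (outside ∷ V) x)
  different x (U , pU) (V , pV) with () ← disjoint _ _ x pU pV
  into : ∀ x → (∃ λ U → P (inside ∷ U) x) ⊎ (∃ λ U → P (outside ∷ U) x) → ∃ λ U → P U x
  into x (inj₁ (U , p)) = inside ∷ U , p
  into x (inj₂ (U , p)) = outside ∷ U , p
  from : ∀ x → (∃ λ U → P U x) → (∃ λ U → P (inside ∷ U) x) ⊎ (∃ λ U → P (outside ∷ U) x)
  from x (inside ∷ U , p)  = inj₁ (U , p)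
  from x (outside ∷ U , p) = inj₂ (U , p)

record Counts (X : Set) (P : ℕ → X → Set) (c : List ℚ) : Set where
  constructor counting
  field represents : Represents c (λ n → Card X (P n))
open Counts public

module _ {X : Set} {P : ℕ → X → Set} where

  Counts-resp : ∀ {Q c} → Counts X P c → (∀ n → 1 ℕ.≤ n → ∀ x → P n x → Q n x) →
                (∀ n → 1 ℕ.≤ n → ∀ x → Q n x → P n x) → Counts X Q c
  Counts-resp (counting r) P⇒Q Q⇒P = counting λ n n≥1 →
    let k , card , k≡c = r n n≥1 in k , Card-resp card (P⇒Q n n≥1) (Q⇒P n n≥1) , k≡c

  Counts-∅ : (∀ n → 1 ℕ.≤ n → ∀ x → ¬ P n x) → Counts X P []
  Counts-∅ ¬P = counting λ n n≥1 → 0 , Card-∅ (¬P n n≥1) , refl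

  Counts-unique : ∀ {c d} → Counts X P c → Counts X P d → ∀ i → coeff c i ≡ coeff d i
  Counts-unique {c} {d} (counting r) (counting r′) = coeff-unique c d λ n n≥1 →
    let k , card , k≡c = r n n≥1 ; l , card′ , l≡d = r′ n n≥1 in
    trans (sym k≡c) (trans (cong toℚ (Card-unique card card′)) l≡d)

Counts-const : ∀ {X : Set} {P : X → Set} {k c} → Card X P k → toℚ k ≡ c → Counts X (λ _ → P) (c ∷ [])
Counts-const {c = c} card k≡c = counting λ n n≥1 →
  _ , card , trans k≡c (sym (trans (cong (c ℚ.+_) (ℚ.*-zeroʳ (toℚ n))) (ℚ.+-identityʳ c)))

Counts-singleton : ∀ {X : Set} (x₀ : ℕ → X) → Counts X (λ n x → x ≡ x₀ n) (1ℚ ∷ [])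
Counts-singleton x₀ = counting λ n → represents (Counts-const (Card-singleton (x₀ n)) refl) n

Counts-⋃ : ∀ {X : Set} m (P : Subset m → ℕ → X → Set) (c : Subset m → List ℚ) →
           (∀ U → Counts X (P U) (c U)) → (∀ n → 1 ℕ.≤ n → ∀ U V x → P U n x → P V n x → U ≡ V) →
           Counts X (λ n x → ∃ λ U → P U n x) (foldSubsets _+ₚ_ m c)
Counts-⋃ m P c counts disjoint = counting λ n n≥1 →
  let k = λ U → proj₁ (represents (counts U) n n≥1)
      card = λ U → proj₁ (proj₂ (represents (counts U) n n≥1))
      k≡c = λ U → proj₂ (proj₂ (represents (counts U) n n≥1))
  in foldSubsets ℕ._+_ m k , Card-⋃ m (λ U → P U n) k card (disjoint n n≥1) , (begin
    toℚ (foldSubsets ℕ._+_ m k)                    ≡⟨ foldSubsets-homo toℚ toℚ-+ m k ⟩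
    foldSubsets ℚ._+_ m (toℚ ∘ k)                  ≡⟨ foldSubsets-cong ℚ._+_ m k≡c ⟩
    foldSubsets ℚ._+_ m (λ U → eval (c U) (toℚ n))
      ≡⟨ foldSubsets-homo (λ p → eval p (toℚ n)) (λ p q → eval-+ₚ p q (toℚ n)) m c ⟨
    eval (foldSubsets _+ₚ_ m c) (toℚ n)            ∎)
  where open ≡-Reasoning

Counts-partition : ∀ {X : Set} {P : ℕ → X → Set} m (class : ℕ → X → Subset m) (c : Subset m → List ℚ) →
                   (∀ U → Counts X (λ n x → P n x × class n x ≡ U) (c U)) →
                   Counts X P (foldSubsets _+ₚ_ m c)
Counts-partition {P = P} m class c counts =
  Counts-resp (Counts-⋃ m (λ U n x → P n x × class n x ≡ U) c counts
                 λ n _ U V x (_ , ≡U) (_ , ≡V) → trans (sym ≡U) ≡V)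
              (λ n _ x (U , px , _) → px) (λ n _ x px → class n x , px , refl)

lookup-extensionality : ∀ {A : Set} {n} {u v : Vec A n} → (∀ i → lookup u i ≡ lookup v i) → u ≡ v
lookup-extensionality {u = u} {v} u≗v =
  trans (sym (Vec.tabulate∘lookup u)) (trans (Vec.tabulate-cong u≗v) (Vec.tabulate∘lookup v))

empty-vectors-equal : ∀ {A : Set} {n} → n ≡ 0 → (u v : Vec A n) → u ≡ v
empty-vectors-equal n≡0 u v = lookup-extensionality λ p → contradiction (subst Fin n≡0 p) λ ()

select : ∀ {n} {P : Fin n → Set} → Decidable P → Subset n
select P? = tabulate (does ∘ P?)

module _ {n} {P : Fin n → Set} (P? : Decidable P) where

  ∈-select⁺ : ∀ {x} → P x → x ∈ select P?
  ∈-select⁺ {x} px = Vec.lookup⇒[]= x _ (trans (Vec.lookup∘tabulate (does ∘ P?) x) (dec-true (P? x) px))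

  ∈-select⁻ : ∀ {x} → x ∈ select P? → P x
  ∈-select⁻ {x} x∈ with P? x | trans (sym (Vec.lookup∘tabulate (does ∘ P?) x)) (Vec.[]=⇒lookup x∈)
  ... | yes px | _ = px

embed : ∀ {n} (S : Subset n) → Fin ∣ S ∣ → Fin n
embed (inside  ∷ S) zero    = zero
embed (inside  ∷ S) (suc i) = suc (embed S i)
embed (outside ∷ S) i       = suc (embed S i)

embed-injective : ∀ {n} (S : Subset n) → Injective _≡_ _≡_ (embed S)
embed-injective (inside  ∷ S) {zero}  {zero}  eq = refl
embed-injective (inside  ∷ S) {suc i} {suc j} eq = cong suc (embed-injective S (Fin.suc-injective eq))
embed-injective (outside ∷ S) {i}     {j}     eq = embed-injective S (Fin.suc-injective eq)

embed-∈ : ∀ {n} (S : Subset n) i → embed S i ∈ S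
embed-∈ (inside  ∷ S) zero    = here
embed-∈ (inside  ∷ S) (suc i) = there (embed-∈ S i)
embed-∈ (outside ∷ S) i       = there (embed-∈ S i)

∈⇒embed : ∀ {n} {S : Subset n} {x} → x ∈ S → ∃ λ i → embed S i ≡ x
∈⇒embed {S = inside  ∷ S} here        = zero , refl
∈⇒embed {S = inside  ∷ S} (there x∈S) = let i , eq = ∈⇒embed x∈S in suc i , cong suc eq
∈⇒embed {S = outside ∷ S} (there x∈S) = let i , eq = ∈⇒embed x∈S in i , cong suc eq

data Side {n} (S : Subset n) : Fin n → Set where
  in-S  : ∀ i → Side S (embed S i)
  in-∁S : ∀ j → Side S (embed (∁ S) j)

side : ∀ {n} (S : Subset n) x → Side S x
side S x with x ∈? S
... | yes x∈S with i , refl ← ∈⇒embed x∈S = in-S i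
... | no  x∉S with j , refl ← ∈⇒embed (x∉p⇒x∈∁p x∉S) = in-∁S j

∣p∣≡0⇒p≡⊥ : ∀ {n} (p : Subset n) → ∣ p ∣ ≡ 0 → p ≡ ⊥
∣p∣≡0⇒p≡⊥ p ∣p∣≡0 = Empty-unique λ (x , x∈p) → contradiction (subst Fin ∣p∣≡0 (proj₁ (∈⇒embed x∈p))) λ ()

∣∁p∣≡0⇒p≡⊤ : ∀ {n} (p : Subset n) → ∣ ∁ p ∣ ≡ 0 → p ≡ ⊤
∣∁p∣≡0⇒p≡⊤ p ∣∁p∣≡0 =
  ∣p∣≡n⇒p≡⊤ (ℕ.≤-antisym (∣p∣≤n p) (ℕ.m∸n≡0⇒m≤n (trans (sym (∣∁p∣≡n∸∣p∣ p)) ∣∁p∣≡0)))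

∣p∣+∣∁p∣≡n : ∀ {n} (p : Subset n) → ∣ p ∣ ℕ.+ ∣ ∁ p ∣ ≡ n
∣p∣+∣∁p∣≡n p = trans (cong (∣ p ∣ ℕ.+_) (∣∁p∣≡n∸∣p∣ p)) (ℕ.m+[n∸m]≡n (∣p∣≤n p))

∁⊥≡⊤ : ∀ {n} → ∁ (⊥ {n}) ≡ ⊤
∁⊥≡⊤ {zero}  = refl
∁⊥≡⊤ {suc n} = cong (inside ∷_) ∁⊥≡⊤

∣∁⊤∣≡0 : ∀ n → ∣ ∁ (⊤ {n}) ∣ ≡ 0
∣∁⊤∣≡0 zero    = refl
∣∁⊤∣≡0 (suc n) = ∣∁⊤∣≡0 n

∣∁p∣<n : ∀ {n} (p : Subset n) → ∣ p ∣ ≢ 0 → ∣ ∁ p ∣ ℕ.< n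
∣∁p∣<n p ∣p∣≢0 = subst (∣ ∁ p ∣ ℕ.<_) (trans (ℕ.+-comm ∣ ∁ p ∣ ∣ p ∣) (∣p∣+∣∁p∣≡n p)) (ℕ.m<m+n _ (ℕ.n≢0⇒n>0 ∣p∣≢0))

∣p∣<n : ∀ {n} (p : Subset n) → ∣ ∁ p ∣ ≢ 0 → ∣ p ∣ ℕ.< n
∣p∣<n p ∣∁p∣≢0 = subst (∣ p ∣ ℕ.<_) (∣p∣+∣∁p∣≡n p) (ℕ.m<m+n _ (ℕ.n≢0⇒n>0 ∣∁p∣≢0))

module _ {A : Set} where

  restrict : ∀ {n} (S : Subset n) → Vec A n → Vec A ∣ S ∣
  restrict S g = tabulate (lookup g ∘ embed S)

  lookup-restrict : ∀ {n} (S : Subset n) (g : Vec A n) i → lookup (restrict S g) i ≡ lookup g (embed S i)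
  lookup-restrict S g = Vec.lookup∘tabulate (lookup g ∘ embed S)

  merge : ∀ {n} (S : Subset n) → Vec A ∣ S ∣ → Vec A ∣ ∁ S ∣ → Vec A n
  merge []            []       []       = []
  merge (inside  ∷ S) (a ∷ g₁) g₂       = a ∷ merge S g₁ g₂
  merge (outside ∷ S) g₁       (b ∷ g₂) = b ∷ merge S g₁ g₂

  lookup-merge-S : ∀ {n} (S : Subset n) g₁ g₂ i → lookup (merge S g₁ g₂) (embed S i) ≡ lookup g₁ i
  lookup-merge-S (inside  ∷ S) (a ∷ g₁) g₂       zero    = refl
  lookup-merge-S (inside  ∷ S) (a ∷ g₁) g₂       (suc i) = lookup-merge-S S g₁ g₂ i
  lookup-merge-S (outside ∷ S) g₁       (b ∷ g₂) i       = lookup-merge-S S g₁ g₂ i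

  lookup-merge-∁S : ∀ {n} (S : Subset n) g₁ g₂ j → lookup (merge S g₁ g₂) (embed (∁ S) j) ≡ lookup g₂ j
  lookup-merge-∁S (inside  ∷ S) (a ∷ g₁) g₂       j       = lookup-merge-∁S S g₁ g₂ j
  lookup-merge-∁S (outside ∷ S) g₁       (b ∷ g₂) zero    = refl
  lookup-merge-∁S (outside ∷ S) g₁       (b ∷ g₂) (suc j) = lookup-merge-∁S S g₁ g₂ j

  restrict-merge : ∀ {n} (S : Subset n) g₁ g₂ → restrict S (merge S g₁ g₂) ≡ g₁
  restrict-merge S g₁ g₂ = lookup-extensionality λ i →
    trans (lookup-restrict S (merge S g₁ g₂) i) (lookup-merge-S S g₁ g₂ i)

  restrict∁-merge : ∀ {n} (S : Subset n) g₁ g₂ → restrict (∁ S) (merge S g₁ g₂) ≡ g₂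
  restrict∁-merge S g₁ g₂ = lookup-extensionality λ j →
    trans (lookup-restrict (∁ S) (merge S g₁ g₂) j) (lookup-merge-∁S S g₁ g₂ j)

  merge-restrict : ∀ {n} (S : Subset n) g → merge S (restrict S g) (restrict (∁ S) g) ≡ g
  merge-restrict S g = lookup-extensionality λ x → agree x (side S x)
    where
    agree : ∀ x → Side S x → lookup (merge S (restrict S g) (restrict (∁ S) g)) x ≡ lookup g x
    agree _ (in-S i)  = trans (lookup-merge-S S _ _ i) (lookup-restrict S g i)
    agree _ (in-∁S j) = trans (lookup-merge-∁S S _ _ j) (lookup-restrict (∁ S) g j)

Card-split : ∀ {A : Set} {n} (S : Subset n) {P : Vec A n → Set} {P₁ P₂ k₁ k₂} →
             (∀ g → P g → P₁ (restrict S g) × P₂ (restrict (∁ S) g)) →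
             (∀ g₁ g₂ → P₁ g₁ → P₂ g₂ → P (merge S g₁ g₂)) →
             Card _ P₁ k₁ → Card _ P₂ k₂ → Card _ P (k₁ ℕ.* k₂)
Card-split S split glue card₁ card₂ =
  Card-image (uncurry (merge S)) merge-injective (Card-× card₁ card₂) (λ (g₁ , g₂) (p₁ , p₂) → glue g₁ g₂ p₁ p₂)
    λ g pg → (restrict S g , restrict (∁ S) g) , split g pg , merge-restrict S g
  where
  merge-injective : ∀ {x y} → uncurry (merge S) x ≡ uncurry (merge S) y → x ≡ y
  merge-injective {g₁ , g₂} {g₁′ , g₂′} eq = cong₂ _,_
    (trans (sym (restrict-merge S g₁ g₂)) (trans (cong (restrict S) eq) (restrict-merge S g₁′ g₂′)))
    (trans (sym (restrict∁-merge S g₁ g₂)) (trans (cong (restrict (∁ S)) eq) (restrict∁-merge S g₁′ g₂′)))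

induced : (Q : FinPoset) → Subset (size Q) → FinPoset
induced Q S = record
  { size  = ∣ S ∣
  ; _≼_   = λ i j → _≼_ Q (embed S i) (embed S j)
  ; isPO  = record
    { isPreorder = record
      { isEquivalence = isEquivalence
      ; reflexive     = λ { refl → IsPartialOrder.refl (isPO Q) }
      ; trans         = IsPartialOrder.trans (isPO Q)
      }
    ; antisym = λ i≼j j≼i → embed-injective S (IsPartialOrder.antisym (isPO Q) i≼j j≼i)
    }
  }

induced-isInducedSubposet : ∀ Q S → IsInducedSubposet Q S (induced Q S)
induced-isInducedSubposet Q S =
  embed S , embed-injective S , embed-∈ S , (λ x → ∈⇒embed) , λ i j → id , id

⊤-isFilter : ∀ Q → IsFilter Q ⊤
⊤-isFilter Q _ q _ _ = ∈⊤

⊥-isFilter : ∀ Q → IsFilter Q ⊥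
⊥-isFilter Q p _ _ p∈⊥ = contradiction p∈⊥ ∉⊥

∁-isIdeal : ∀ Q {U} → IsFilter Q U → IsIdeal Q (∁ U)
∁-isIdeal Q U-filter p q p≼q q∈∁U = x∉p⇒x∈∁p λ p∈U → x∈∁p⇒x∉p q∈∁U (U-filter p q p≼q p∈U)

Monotone : (Q : FinPoset) → Vec ℤ (size Q) → Set
Monotone Q g = ∀ p q → _≼_ Q p q → lookup g p ℤ.≤ lookup g q

Bounds : FinPoset → Set₁
Bounds Q = Fin (size Q) → ℤ → Set

MonotoneWithin : (Q : FinPoset) → Bounds Q → Vec ℤ (size Q) → Set
MonotoneWithin Q B g = Monotone Q g × ∀ p → B p (lookup g p)

MonotoneWithin-mono : ∀ R {B C : Bounds R} → (∀ p z → B p z → C p z) →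
                      ∀ g → MonotoneWithin R B g → MonotoneWithin R C g
MonotoneWithin-mono R B⇒C g (g-mono , g-within) = g-mono , λ p → B⇒C p _ (g-within p)

restrict-monotone : ∀ Q S g → Monotone Q g → Monotone (induced Q S) (restrict S g)
restrict-monotone Q S g g-mono i j i≼j = subst₂ ℤ._≤_
  (sym (lookup-restrict S g i)) (sym (lookup-restrict S g j)) (g-mono _ _ i≼j)

restrict-within : ∀ Q S {C : Bounds (induced Q S)} g → (∀ i → C i (lookup g (embed S i))) →
                  ∀ i → C i (lookup (restrict S g) i)
restrict-within Q S {C} g bounded i = subst (C i) (sym (lookup-restrict S g i)) (bounded i)

Card-emptyPoset : ∀ R (B : Bounds R) → size R ≡ 0 → Card (Vec ℤ (size R)) (MonotoneWithin R B) 1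
Card-emptyPoset R B size≡0 = Card-resp (Card-singleton (Vec.replicate _ (+ 0)))
  (λ g _ → (λ p → contradiction (subst Fin size≡0 p) λ ()) , (λ p → contradiction (subst Fin size≡0 p) λ ()))
  (λ g _ → empty-vectors-equal size≡0 g _)

Card-induced-⊤ : ∀ Q (B : Bounds Q) {k} →
                 Card _ (MonotoneWithin (induced Q ⊤) (B ∘ embed ⊤)) k → Card _ (MonotoneWithin Q B) k
Card-induced-⊤ Q B {k} card = subst (Card _ _) (ℕ.*-identityʳ k)
  (Card-split all split glue card (Card-singleton (Vec.replicate _ (+ 0))))
  where
  all : Subset (size Q)
  all = ⊤
  split : ∀ g → MonotoneWithin Q B g →
          MonotoneWithin (induced Q all) (B ∘ embed all) (restrict all g) ×
          restrict (∁ all) g ≡ Vec.replicate _ (+ 0)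
  split g (g-mono , g-within) =
    (restrict-monotone Q all g g-mono , restrict-within Q all {B ∘ embed all} g (g-within ∘ embed all)) ,
    empty-vectors-equal (∣∁⊤∣≡0 (size Q)) _ _
  glue : ∀ g₁ g₂ → MonotoneWithin (induced Q all) (B ∘ embed all) g₁ → g₂ ≡ Vec.replicate _ (+ 0) →
         MonotoneWithin Q B (merge all g₁ g₂)
  glue g₁ g₂ (g₁-mono , g₁-within) _ = mono , λ p → within p (side all p)
    where
    absurd : ∀ {A : Set} → Fin ∣ ∁ all ∣ → A
    absurd j = contradiction (subst Fin (∣∁⊤∣≡0 (size Q)) j) λ ()
    mono : Monotone Q (merge all g₁ g₂)
    mono p q p≼q with side all p | side all q
    ... | in-S i  | in-S i′  = subst₂ ℤ._≤_ (sym (lookup-merge-S all g₁ g₂ i)) (sym (lookup-merge-S all g₁ g₂ i′))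
                                 (g₁-mono i i′ p≼q)
    ... | in-∁S j | _        = absurd j
    ... | _       | in-∁S j  = absurd j
    within : ∀ p → Side all p → B p (lookup (merge all g₁ g₂) p)
    within _ (in-S i)  = subst (B _) (sym (lookup-merge-S all g₁ g₂ i)) (g₁-within i)
    within _ (in-∁S j) = absurd j

above : ∀ {n} → ℤ → Vec ℤ n → Subset n
above t g = select (λ x → t ℤ.<? lookup g x)

module _ {n} (t : ℤ) (g : Vec ℤ n) where

  ∈-above⁺ : ∀ {x} → t ℤ.< lookup g x → x ∈ above t g
  ∈-above⁺ = ∈-select⁺ (λ x → t ℤ.<? lookup g x)

  ∈-above⁻ : ∀ {x} → x ∈ above t g → t ℤ.< lookup g x
  ∈-above⁻ = ∈-select⁻ (λ x → t ℤ.<? lookup g x)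

  ∉-above⁻ : ∀ {x} → x ∈ ∁ (above t g) → lookup g x ℤ.≤ t
  ∉-above⁻ x∉ = ℤ.≮⇒≥ λ t<gx → x∈∁p⇒x∉p x∉ (∈-above⁺ t<gx)

above-isFilter : ∀ Q t g → Monotone Q g → IsFilter Q (above t g)
above-isFilter Q t g g-mono p q p≼q p∈ = ∈-above⁺ t g (ℤ.<-≤-trans (∈-above⁻ t g p∈) (g-mono p q p≼q))

module _ (Q : FinPoset) (t : ℤ) (B : Bounds Q) (U : Subset (size Q)) where

  BoundsAbove : Bounds (induced Q U)
  BoundsAbove i z = B (embed U i) z × t ℤ.< z

  BoundsBelow : Bounds (induced Q (∁ U))
  BoundsBelow j z = B (embed (∁ U) j) z × z ℤ.≤ t

  WithinAbove : Vec ℤ (size Q) → Set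
  WithinAbove g = MonotoneWithin Q B g × above t g ≡ U

  threshold-split : ∀ g → WithinAbove g →
                    MonotoneWithin (induced Q U) BoundsAbove (restrict U g) ×
                    MonotoneWithin (induced Q (∁ U)) BoundsBelow (restrict (∁ U) g)
  threshold-split g ((g-mono , g-within) , above≡U) =
    (restrict-monotone Q U g g-mono ,
     restrict-within Q U {BoundsAbove} g λ i →
       g-within _ , ∈-above⁻ t g (subst (embed U i ∈_) (sym above≡U) (embed-∈ U i))) ,
    (restrict-monotone Q (∁ U) g g-mono ,
     restrict-within Q (∁ U) {BoundsBelow} g λ j →
       g-within _ , ∉-above⁻ t g (subst (λ S → embed (∁ U) j ∈ ∁ S) (sym above≡U) (embed-∈ (∁ U) j)))

  threshold-glue : IsFilter Q U → ∀ g₁ g₂ →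
                   MonotoneWithin (induced Q U) BoundsAbove g₁ →
                   MonotoneWithin (induced Q (∁ U)) BoundsBelow g₂ → WithinAbove (merge U g₁ g₂)
  threshold-glue U-filter g₁ g₂ (g₁-mono , g₁-within) (g₂-mono , g₂-within) =
    (mono , λ p → within p (side U p)) , ⊆-antisym above⊆U U⊆above
    where
    g = merge U g₁ g₂
    mono : Monotone Q g
    mono p q p≼q with side U p | side U q
    ... | in-S i  | in-S i′  = subst₂ ℤ._≤_ (sym (lookup-merge-S U g₁ g₂ i)) (sym (lookup-merge-S U g₁ g₂ i′))
                                 (g₁-mono i i′ p≼q)
    ... | in-∁S j | in-∁S j′ = subst₂ ℤ._≤_ (sym (lookup-merge-∁S U g₁ g₂ j)) (sym (lookup-merge-∁S U g₁ g₂ j′))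
                                 (g₂-mono j j′ p≼q)
    ... | in-∁S j | in-S i′  = subst₂ ℤ._≤_ (sym (lookup-merge-∁S U g₁ g₂ j)) (sym (lookup-merge-S U g₁ g₂ i′))
                                 (ℤ.<⇒≤ (ℤ.≤-<-trans (proj₂ (g₂-within j)) (proj₂ (g₁-within i′))))
    ... | in-S i  | in-∁S j′ = contradiction (U-filter _ _ p≼q (embed-∈ U i)) (x∈∁p⇒x∉p (embed-∈ (∁ U) j′))
    within : ∀ p → Side U p → B p (lookup g p)
    within _ (in-S i)  = subst (B _) (sym (lookup-merge-S U g₁ g₂ i)) (proj₁ (g₁-within i))
    within _ (in-∁S j) = subst (B _) (sym (lookup-merge-∁S U g₁ g₂ j)) (proj₁ (g₂-within j))
    above⊆U : ∀ {x} → x ∈ above t g → x ∈ U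
    above⊆U {x} x∈ with side U x
    ... | in-S i  = embed-∈ U i
    ... | in-∁S j = contradiction (subst (t ℤ.<_) (lookup-merge-∁S U g₁ g₂ j) (∈-above⁻ t g x∈))
                                  (ℤ.≤⇒≯ (proj₂ (g₂-within j)))
    U⊆above : ∀ {x} → x ∈ U → x ∈ above t g
    U⊆above x∈U with i , refl ← ∈⇒embed x∈U =
      ∈-above⁺ t g (subst (t ℤ.<_) (sym (lookup-merge-S U g₁ g₂ i)) (proj₂ (g₁-within i)))

  Card-threshold : IsFilter Q U → ∀ {k₁ k₂} →
                   Card _ (MonotoneWithin (induced Q U) BoundsAbove) k₁ →
                   Card _ (MonotoneWithin (induced Q (∁ U)) BoundsBelow) k₂ →
                   Card _ WithinAbove (k₁ ℕ.* k₂)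
  Card-threshold U-filter = Card-split U threshold-split (threshold-glue U-filter)

Counts-threshold : ∀ Q (t : ℕ → ℤ) (B : ℕ → Bounds Q) U {c d} → IsFilter Q U →
                   Counts _ (λ n → MonotoneWithin (induced Q U) (BoundsAbove Q (t n) (B n) U)) c →
                   Counts _ (λ n → MonotoneWithin (induced Q (∁ U)) (BoundsBelow Q (t n) (B n) U)) d →
                   Counts _ (λ n → WithinAbove Q (t n) (B n) U) (c *ₚ d)
Counts-threshold Q t B U {c} {d} U-filter (counting r₁) (counting r₂) = counting λ n n≥1 →
  let k₁ , card₁ , k₁≡c = r₁ n n≥1 ; k₂ , card₂ , k₂≡d = r₂ n n≥1 in
  k₁ ℕ.* k₂ , Card-threshold Q (t n) (B n) U U-filter card₁ card₂ ,
  trans (toℚ-* k₁ k₂) (trans (cong₂ ℚ._*_ k₁≡c k₂≡d) (sym (eval-*ₚ c d (toℚ n))))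

Counts-bounds : ∀ R {B C : ℕ → Bounds R} {c} → Counts _ (λ n → MonotoneWithin R (B n)) c →
                (∀ n → 1 ℕ.≤ n → ∀ p z → B n p z → C n p z) → (∀ n → 1 ℕ.≤ n → ∀ p z → C n p z → B n p z) →
                Counts _ (λ n → MonotoneWithin R (C n)) c
Counts-bounds R counts B⇒C C⇒B = Counts-resp counts
  (λ n n≥1 → MonotoneWithin-mono R (B⇒C n n≥1)) (λ n n≥1 → MonotoneWithin-mono R (C⇒B n n≥1))

InBand : ℤ → ℕ → ℤ → Set
InBand s n z = s ℤ.< z × z ℤ.≤ s ℤ.+ + n

Band : (Q : FinPoset) → ℤ → ℕ → Vec ℤ (size Q) → Set
Band Q s n = MonotoneWithin Q (λ _ → InBand s n)

module _ {n : ℕ} (s : ℤ) where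

  toInterval : Fin n → ℤ
  toInterval i = s ℤ.+ + suc (Fin.toℕ i)

  toInterval-mono : ∀ {i j} → i Fin.≤ j → toInterval i ℤ.≤ toInterval j
  toInterval-mono i≤j = ℤ.+-monoʳ-≤ s (ℤ.+≤+ (s≤s i≤j))

  toInterval-cancel : ∀ {i j} → toInterval i ℤ.≤ toInterval j → i Fin.≤ j
  toInterval-cancel le =
    ℕ.s≤s⁻¹ (ℤ.drop‿+≤+ (subst₂ ℤ._≤_ (-s+[s+a]≡a s _) (-s+[s+a]≡a s _) (ℤ.+-monoʳ-≤ (ℤ.- s) le)))
    where
    -s+[s+a]≡a : ∀ s a → ℤ.- s ℤ.+ (s ℤ.+ a) ≡ a
    -s+[s+a]≡a = solve-∀

  toInterval-∈ : ∀ i → InBand s n (toInterval i)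
  toInterval-∈ i = subst (ℤ._< toInterval i) (ℤ.+-identityʳ s) (ℤ.+-monoʳ-< s (ℤ.+<+ ℕ.z<s)) ,
                   ℤ.+-monoʳ-≤ s (ℤ.+≤+ (Fin.toℕ<n i))

  fromInterval : ∀ z → InBand s n z → ∃ λ i → toInterval i ≡ z
  fromInterval z (s<z , z≤s+n) =
    let i , i≡z-s = positive-index (z ℤ.- s) 0<z-s z-s≤n in i , trans (cong (λ d → s ℤ.+ d) i≡z-s) (s+[z-s]≡z s z)
    where
    s+[z-s]≡z : ∀ s z → s ℤ.+ (z ℤ.- s) ≡ z
    s+[z-s]≡z = solve-∀
    [s+n]-s≡n : ∀ s n → (s ℤ.+ n) ℤ.- s ≡ n
    [s+n]-s≡n = solve-∀
    0<z-s : + 0 ℤ.< z ℤ.- s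
    0<z-s = subst (ℤ._< z ℤ.- s) (ℤ.+-inverseʳ s) (ℤ.+-monoˡ-< (ℤ.- s) s<z)
    z-s≤n : z ℤ.- s ℤ.≤ + n
    z-s≤n = subst (z ℤ.- s ℤ.≤_) ([s+n]-s≡n s (+ n)) (ℤ.+-monoˡ-≤ (ℤ.- s) z≤s+n)
    positive-index : ∀ d → + 0 ℤ.< d → d ℤ.≤ + n → ∃ λ (i : Fin n) → + suc (Fin.toℕ i) ≡ d
    positive-index (+ zero)  (ℤ.+<+ ()) _
    positive-index (+ suc m) _ d≤n =
      Fin.fromℕ< (ℤ.drop‿+≤+ d≤n) , cong (+_ ∘ suc) (Fin.toℕ-fromℕ< (ℤ.drop‿+≤+ d≤n))

Card-band : ∀ Q n s {k} → OrderPolyValue Q n k → Card (Vec ℤ (size Q)) (Band Q s n) k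
Card-band Q n s card = Card-image (Vec.map (toInterval s)) map-injective card
  (λ v v-mono → (λ p q p≼q → subst₂ ℤ._≤_ (sym (lookup-map p v)) (sym (lookup-map q v))
                                         (toInterval-mono s (v-mono p q p≼q))) ,
                λ p → subst (InBand s n) (sym (lookup-map p v)) (toInterval-∈ s (lookup v p)))
  decode
  where
  lookup-map : ∀ p v → lookup (Vec.map (toInterval s) v) p ≡ toInterval s (lookup v p)
  lookup-map p v = Vec.lookup-map p (toInterval s) v
  map-injective : ∀ {u v} → Vec.map (toInterval s) u ≡ Vec.map (toInterval s) v → u ≡ v
  map-injective {u} {v} eq = lookup-extensionality λ p →
    let at-p = trans (sym (lookup-map p u)) (trans (cong (λ w → lookup w p) eq) (lookup-map p v)) in
    Fin.≤-antisym (toInterval-cancel s (ℤ.≤-reflexive at-p)) (toInterval-cancel s (ℤ.≤-reflexive (sym at-p)))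
  decode : ∀ g → Band Q s n g → ∃ λ v → OrderPreserving Q n v × Vec.map (toInterval s) v ≡ g
  decode g (g-mono , g-within) = v , v-mono , lookup-extensionality λ p → trans (lookup-map p v) (v≡g p)
    where
    index : ∀ p → ∃ λ i → toInterval s i ≡ lookup g p
    index p = fromInterval s (lookup g p) (g-within p)
    v : Vec (Fin n) (size Q)
    v = tabulate (proj₁ ∘ index)
    v≡g : ∀ p → toInterval s (lookup v p) ≡ lookup g p
    v≡g p = trans (cong (toInterval s) (Vec.lookup∘tabulate (proj₁ ∘ index) p)) (proj₂ (index p))
    v-mono : OrderPreserving Q n v
    v-mono p q p≼q = toInterval-cancel s (subst₂ ℤ._≤_ (sym (v≡g p)) (sym (v≡g q)) (g-mono p q p≼q))

InBox : ℤ → ℤ → ℕ → ℤ → Set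
InBox lo hi n z = + n ℤ.* lo ℤ.≤ z × z ℤ.≤ + n ℤ.* hi

Box : (Q : FinPoset) → (lo hi : Fin (size Q) → ℤ) → ℕ → Bounds Q
Box Q lo hi n p = InBox (lo p) (hi p) n

*-cancel-≤ : ∀ {n x y} → 1 ℕ.≤ n → + n ℤ.* x ℤ.≤ + n ℤ.* y → x ℤ.≤ y
*-cancel-≤ {suc n} {x} {y} _ = ℤ.*-cancelˡ-≤-pos x y (+ suc n)

*-mono-< : ∀ {n x y} → 1 ℕ.≤ n → x ℤ.< y → + n ℤ.* x ℤ.< + n ℤ.* y
*-mono-< {suc n} _ = ℤ.*-monoˡ-<-pos (+ suc n)

*-mono-≤ : ∀ n {x y} → x ℤ.≤ y → + n ℤ.* x ℤ.≤ + n ℤ.* y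
*-mono-≤ n = ℤ.*-monoˡ-≤-nonNeg (+ n)

*-suc : ∀ n s → + n ℤ.* (s ℤ.+ + 1) ≡ + n ℤ.* s ℤ.+ + n
*-suc n s = trans (ℤ.*-distribˡ-+ (+ n) s (+ 1)) (cong (λ z → + n ℤ.* s ℤ.+ z) (ℤ.*-identityʳ (+ n)))

flat-box-counts : ∀ Q (a : ℤ) (lo hi : Fin (size Q) → ℤ) →
                  (∀ p → a ℤ.≤ lo p) → (∀ p → hi p ℤ.≤ a ℤ.+ + 0) →
                  ∃ λ c → NonNeg c × Counts _ (λ n → MonotoneWithin Q (Box Q lo hi n)) c
flat-box-counts Q a lo hi a≤lo hi≤a with Fin.all? (λ p → lo p ℤ.≤? hi p)
... | no  lo≰hi = [] , [] , Counts-∅ λ n n≥1 g (_ , g-within) →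
  lo≰hi λ p → *-cancel-≤ n≥1 (ℤ.≤-trans (proj₁ (g-within p)) (proj₂ (g-within p)))
... | yes lo≤hi = (1ℚ ∷ []) , ℚ.<⇒≤ (ℚ.positive⁻¹ 1ℚ) ∷ [] ,
  Counts-resp (Counts-singleton (λ n → Vec.replicate _ (+ n ℤ.* a))) constant⇒box box⇒constant
  where
  lo≡a : ∀ p → lo p ≡ a
  lo≡a p = ℤ.≤-antisym (ℤ.≤-trans (lo≤hi p) (subst (hi p ℤ.≤_) (ℤ.+-identityʳ a) (hi≤a p))) (a≤lo p)
  hi≡a : ∀ p → hi p ≡ a
  hi≡a p = ℤ.≤-antisym (subst (hi p ℤ.≤_) (ℤ.+-identityʳ a) (hi≤a p)) (ℤ.≤-trans (a≤lo p) (lo≤hi p))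
  constant⇒box : ∀ n → 1 ℕ.≤ n → ∀ g → g ≡ Vec.replicate _ (+ n ℤ.* a) → MonotoneWithin Q (Box Q lo hi n) g
  constant⇒box n _ g refl =
    (λ p q _ → ℤ.≤-reflexive (trans (Vec.lookup-replicate p _) (sym (Vec.lookup-replicate q _)))) ,
    λ p → subst (InBox (lo p) (hi p) n) (sym (Vec.lookup-replicate p _))
            (ℤ.≤-reflexive (cong (+ n ℤ.*_) (lo≡a p)) , ℤ.≤-reflexive (cong (+ n ℤ.*_) (sym (hi≡a p))))
  box⇒constant : ∀ n → 1 ℕ.≤ n → ∀ g → MonotoneWithin Q (Box Q lo hi n) g → g ≡ Vec.replicate _ (+ n ℤ.* a)
  box⇒constant n _ g (_ , g-within) = lookup-extensionality λ p → trans
    (ℤ.≤-antisym (subst (λ h → lookup g p ℤ.≤ + n ℤ.* h) (hi≡a p) (proj₂ (g-within p)))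
                 (subst (λ l → + n ℤ.* l ℤ.≤ lookup g p) (lo≡a p) (proj₁ (g-within p))))
    (sym (Vec.lookup-replicate p _))

-- The order of a FinPoset need not be decidable; decOrder below decides its double negation.
DecOrder : FinPoset → Set
DecOrder Q = ∀ p q → Dec (¬ ¬ _≼_ Q p q)

¬¬-decidable : ∀ n (A : Fin n → Set) → ¬ ¬ (∀ x → Dec (A x))
¬¬-decidable zero    A k = k λ ()
¬¬-decidable (suc n) A k =
  ¬¬-excluded-middle λ A₀? → ¬¬-decidable n (A ∘ suc) λ A₊? → k λ { zero → A₀? ; (suc x) → A₊? x }

-- Knowing all monotone maps into Fin 2 decides p ≼ q up to double negation: if p ⋠ q,
-- the indicator of the up-set of p is a monotone map separating p from q.
decOrder : ∀ Q {k} → OrderPolyValue Q 2 k → DecOrder Q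
decOrder Q (f , _ , f-mono , f-onto) p q
  with Fin.any? (λ i → (lookup (f i) p Fin.≟ suc zero) ×-dec (lookup (f i) q Fin.≟ zero))
... | yes (i , fp≡1 , fq≡0) = no λ ¬¬p≼q → ¬¬p≼q λ p≼q → 1≰0 (subst₂ Fin._≤_ fp≡1 fq≡0 (f-mono i p q p≼q))
  where
  1≰0 : ¬ (Fin.suc {1} zero Fin.≤ Fin.zero {1})
  1≰0 ()
... | no no-separator = yes λ p⋠q → ¬¬-decidable (size Q) (_≼_ Q p) λ p≼? →
  let i , fi≡indicator = f-onto (indicator p≼?) (indicator-mono p≼?) in
  no-separator (i , trans (cong (λ v → lookup v p) fi≡indicator) (indicator-p p≼?)
                  , trans (cong (λ v → lookup v q) fi≡indicator) (indicator-q p≼? p⋠q))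
  where
  if-≼ : ∀ {x} → Dec (_≼_ Q p x) → Fin 2
  if-≼ (yes _) = suc zero
  if-≼ (no _)  = zero
  indicator : (∀ x → Dec (_≼_ Q p x)) → Vec (Fin 2) (size Q)
  indicator p≼? = tabulate (λ x → if-≼ (p≼? x))
  indicator-mono : ∀ p≼? → OrderPreserving Q 2 (indicator p≼?)
  indicator-mono p≼? x y x≼y
    rewrite Vec.lookup∘tabulate (λ x → if-≼ (p≼? x)) x | Vec.lookup∘tabulate (λ x → if-≼ (p≼? x)) y
    with p≼? x | p≼? y
  ... | yes _   | yes _   = ℕ.≤-refl
  ... | yes p≼x | no  p⋠y = contradiction (IsPartialOrder.trans (isPO Q) p≼x x≼y) p⋠y
  ... | no  _   | _       = ℕ.z≤n
  indicator-p : ∀ p≼? → lookup (indicator p≼?) p ≡ suc zero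
  indicator-p p≼? rewrite Vec.lookup∘tabulate (λ x → if-≼ (p≼? x)) p with p≼? p
  ... | yes _   = refl
  ... | no  p⋠p = contradiction (IsPartialOrder.refl (isPO Q)) p⋠p
  indicator-q : ∀ p≼? → ¬ _≼_ Q p q → lookup (indicator p≼?) q ≡ zero
  indicator-q p≼? p⋠q rewrite Vec.lookup∘tabulate (λ x → if-≼ (p≼? x)) q with p≼? q
  ... | yes p≼q = contradiction p≼q p⋠q
  ... | no  _   = refl

isFilter? : ∀ Q → DecOrder Q → ∀ U → Dec (IsFilter Q U)
isFilter? Q _≼?_ U = map′ from to (Fin.all? λ p → Fin.all? λ q → (p ≼? q) →-dec ((p ∈? U) →-dec (q ∈? U)))
  where
  from : (∀ p q → ¬ ¬ _≼_ Q p q → p ∈ U → q ∈ U) → IsFilter Q U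
  from closed p q p≼q = closed p q λ p⋠q → p⋠q p≼q
  to : IsFilter Q U → ∀ p q → ¬ ¬ _≼_ Q p q → p ∈ U → q ∈ U
  to U-filter p q ¬¬p≼q p∈U = decidable-stable (q ∈? U) λ q∉U → ¬¬p≼q λ p≼q → q∉U (U-filter p q p≼q p∈U)

monotone-¬¬ : ∀ Q g → Monotone Q g → ∀ {p q} → ¬ ¬ _≼_ Q p q → lookup g p ℤ.≤ lookup g q
monotone-¬¬ Q g g-mono {p} {q} ¬¬p≼q =
  decidable-stable (lookup g p ℤ.≤? lookup g q) λ gp≰gq → ¬¬p≼q λ p≼q → gp≰gq (g-mono p q p≼q)

module _ (Q : FinPoset) (_≼?_ : DecOrder Q) (S : Subset (size Q)) where

  above-some? : ∀ x → Dec (∃ λ f → f ∈ S × ¬ ¬ _≼_ Q f x)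
  above-some? x = Fin.any? (λ f → (f ∈? S) ×-dec (f ≼? x))

  upClosure : Subset (size Q)
  upClosure = select above-some?

  ⊆-upClosure : ∀ {f} → f ∈ S → f ∈ upClosure
  ⊆-upClosure {f} f∈S = ∈-select⁺ above-some? (f , f∈S , λ f⋠f → f⋠f (IsPartialOrder.refl (isPO Q)))

  ∈-upClosure⁻ : ∀ {x} → x ∈ upClosure → ∃ λ f → f ∈ S × ¬ ¬ _≼_ Q f x
  ∈-upClosure⁻ = ∈-select⁻ above-some?

  upClosure-isFilter : IsFilter Q upClosure
  upClosure-isFilter p q p≼q p∈ = let f , f∈S , ¬¬f≼p = ∈-upClosure⁻ p∈ in
    ∈-select⁺ above-some? (f , f∈S , λ f⋠q → ¬¬f≼p λ f≼p → f⋠q (IsPartialOrder.trans (isPO Q) f≼p p≼q))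

dual : FinPoset → FinPoset
dual Q = record
  { size = size Q
  ; _≼_  = λ p q → _≼_ Q q p
  ; isPO = record
    { isPreorder = record
      { isEquivalence = isEquivalence
      ; reflexive     = λ { refl → IsPartialOrder.refl (isPO Q) }
      ; trans         = λ p≽q q≽r → IsPartialOrder.trans (isPO Q) q≽r p≽q
      }
    ; antisym = λ p≽q q≽p → IsPartialOrder.antisym (isPO Q) q≽p p≽q
    }
  }

module _ (Q : FinPoset) (_≼?_ : DecOrder Q) where

  open FinPoset Q using () renaming (_≼_ to _⊑_)

  downset : Fin (size Q) → Subset (size Q)
  downset p = select (_≼? p)

  -- Terminates because passing to a strictly smaller element shrinks the down-set.
  minimal-below : ∀ p → ∃ λ m → ¬ ¬ m ⊑ p × IsMinimal Q m
  minimal-below p = descend p (<-wellFounded ∣ downset p ∣)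
    where
    descend : ∀ p → Acc ℕ._<_ ∣ downset p ∣ → ∃ λ m → ¬ ¬ m ⊑ p × IsMinimal Q m
    descend p (acc rec) with Fin.any? (λ q → ¬? (q Fin.≟ p) ×-dec (q ≼? p))
    ... | no  none = p , (λ p⋠p → p⋠p (IsPartialOrder.refl (isPO Q))) ,
                     λ q q≼p → decidable-stable (q Fin.≟ p) λ q≢p → none (q , q≢p , λ q⋠p → q⋠p q≼p)
    ... | yes (q , q≢p , ¬¬q≼p) =
      let m , ¬¬m≼q , m-minimal = descend q (rec (p⊂q⇒∣p∣<∣q∣ ↓q⊂↓p)) in
      m , (λ m⋠p → ¬¬m≼q λ m≼q → ¬¬q≼p λ q≼p → m⋠p (IsPartialOrder.trans (isPO Q) m≼q q≼p)) , m-minimal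
      where
      ↓q⊂↓p : downset q ⊂ downset p
      ↓q⊂↓p = (λ x∈↓q → ∈-select⁺ (_≼? p) λ x⋠p → ∈-select⁻ (_≼? q) x∈↓q λ x≼q → ¬¬q≼p λ q≼p →
                  x⋠p (IsPartialOrder.trans (isPO Q) x≼q q≼p)) ,
              p , ∈-select⁺ (_≼? p) (λ p⋠p → p⋠p (IsPartialOrder.refl (isPO Q))) ,
              λ p∈↓q → ∈-select⁻ (_≼? q) p∈↓q λ p≼q → ¬¬q≼p λ q≼p → q≢p (IsPartialOrder.antisym (isPO Q) q≼p p≼q)

maximal-above : ∀ Q → DecOrder Q → ∀ p → ∃ λ m → ¬ ¬ _≼_ Q p m × IsMaximal Q m
maximal-above Q _≼?_ = minimal-below (dual Q) (λ p q → q ≼? p)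

-- Order polynomials and boxes in the family

module Family (F : FinPoset → Set) (closed : ClosedUnderIdealsFilters F)
              (linear-nonneg : ∀ P → F P → LinearCoeffNonneg P) where

  Ω : ∀ Q → F Q → List ℚ
  Ω Q fQ = proj₁ (linear-nonneg Q fQ)

  Ω-represents : ∀ Q fQ → Represents (Ω Q fQ) (OrderPolyValue Q)
  Ω-represents Q fQ = proj₁ (proj₂ (linear-nonneg Q fQ))

  Ω-counts : ∀ Q fQ (s : ℕ → ℤ) → Counts (Vec ℤ (size Q)) (λ n → Band Q (s n) n) (Ω Q fQ)
  Ω-counts Q fQ s = counting λ n n≥1 →
    let k , card , k≡Ω = Ω-represents Q fQ n n≥1 in k , Card-band Q n (s n) card , k≡Ω

  decOrderF : ∀ Q → F Q → DecOrder Q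
  decOrderF Q fQ = decOrder Q (proj₁ (proj₂ (Ω-represents Q fQ 2 (s≤s ℕ.z≤n))))

  F-filter : ∀ {Q U} → F Q → IsFilter Q U → F (induced Q U)
  F-filter {Q} {U} fQ U-filter = closed Q fQ U (inj₂ U-filter) _ (induced-isInducedSubposet Q U)

  F-ideal : ∀ {Q U} → F Q → IsFilter Q U → F (induced Q (∁ U))
  F-ideal {Q} {U} fQ U-filter =
    closed Q fQ (∁ U) (inj₁ (∁-isIdeal Q U-filter)) _ (induced-isInducedSubposet Q (∁ U))

  Ω-empty : ∀ Q fQ → size Q ≡ 0 → ∀ i → coeff (Ω Q fQ) i ≡ coeff (1ℚ ∷ []) i
  Ω-empty Q fQ size≡0 = Counts-unique {d = 1ℚ ∷ []} (Ω-counts Q fQ (λ _ → + 0))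
    (counting λ n → represents (Counts-const (Card-emptyPoset Q (λ _ → InBand (+ 0) n) size≡0) refl) n)

  Ω-full : ∀ Q fQ S fS → S ≡ ⊤ → ∀ i → coeff (Ω (induced Q S) fS) i ≡ coeff (Ω Q fQ) i
  Ω-full Q fQ _ fS refl = Counts-unique counts-on-Q (Ω-counts Q fQ (λ _ → + 0))
    where
    counts-on-Q : Counts _ (λ n → Band Q (+ 0) n) (Ω (induced Q ⊤) fS)
    counts-on-Q = counting λ n n≥1 →
      let k , card , k≡Ω = represents (Ω-counts (induced Q ⊤) fS (λ _ → + 0)) n n≥1 in
      k , Card-induced-⊤ Q (λ _ → InBand (+ 0) n) card , k≡Ω

  module _ (Q : FinPoset) (fQ : F Q) where

    filter? : ∀ U → Dec (IsFilter Q U)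
    filter? = isFilter? Q (decOrderF Q fQ)

    -- The part of Ω_Q (x + y) where exactly the filter U takes values above x,
    -- as a polynomial in y: Ω_U (y) · Ω_{Q ∖ U} (x).
    cut : ℕ → ∀ U → Dec (IsFilter Q U) → List ℚ
    cut x U (yes U-filter) =
      Ω (induced Q U) (F-filter fQ U-filter) *ₚ (eval (Ω (induced Q (∁ U)) (F-ideal fQ U-filter)) (toℚ x) ∷ [])
    cut x U (no _) = []

    cut-counts : ∀ x → 1 ℕ.≤ x → ∀ U d →
                 Counts _ (λ y g → Band Q (+ 0) (x ℕ.+ y) g × above (+ x) g ≡ U) (cut x U d)
    cut-counts x x≥1 U (no ¬filter) = Counts-∅ λ y _ g (g-band , above≡U) →
      ¬filter (subst (IsFilter Q) above≡U (above-isFilter Q (+ x) g (proj₁ g-band)))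
    cut-counts x x≥1 U (yes U-filter) = Counts-threshold Q (λ _ → + x) bounds U U-filter top bottom
      where
      bounds : ℕ → Bounds Q
      bounds y _ = InBand (+ 0) (x ℕ.+ y)
      fU = F-filter fQ U-filter
      fQ∖U = F-ideal fQ U-filter
      top : Counts _ (λ y → MonotoneWithin (induced Q U) (BoundsAbove Q (+ x) (bounds y) U)) (Ω (induced Q U) fU)
      top = Counts-bounds (induced Q U) {λ y _ → InBand (+ x) y} {λ y → BoundsAbove Q (+ x) (bounds y) U}
        (Ω-counts (induced Q U) fU (λ _ → + x))
        (λ y _ i z (x<z , z≤x+y) → (ℤ.≤-<-trans (ℤ.+≤+ ℕ.z≤n) x<z , z≤x+y) , x<z)
        (λ y _ i z ((_ , z≤x+y) , x<z) → x<z , z≤x+y)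
      Ω∖U-at-x : ∃ λ k → OrderPolyValue (induced Q (∁ U)) x k × toℚ k ≡ eval (Ω (induced Q (∁ U)) fQ∖U) (toℚ x)
      Ω∖U-at-x = Ω-represents (induced Q (∁ U)) fQ∖U x x≥1
      bottom : Counts _ (λ y → MonotoneWithin (induced Q (∁ U)) (BoundsBelow Q (+ x) (bounds y) U))
                      (eval (Ω (induced Q (∁ U)) fQ∖U) (toℚ x) ∷ [])
      bottom = Counts-bounds (induced Q (∁ U)) {λ _ _ → InBand (+ 0) x} {λ y → BoundsBelow Q (+ x) (bounds y) U}
        (Counts-const (Card-band (induced Q (∁ U)) x (+ 0) (proj₁ (proj₂ Ω∖U-at-x))) (proj₂ (proj₂ Ω∖U-at-x)))
        (λ y _ j z (0<z , z≤x) → (0<z , ℤ.≤-trans z≤x (ℤ.+≤+ (ℕ.m≤m+n x y))) , z≤x)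
        (λ y _ j z ((0<z , _) , z≤x) → 0<z , z≤x)

    shift-counts : ∀ x → Counts _ (λ y → Band Q (+ 0) (x ℕ.+ y)) (shift (toℚ x) (Ω Q fQ))
    shift-counts x = counting λ y y≥1 →
      let k , card , k≡Ω = represents (Ω-counts Q fQ (λ _ → + 0)) (x ℕ.+ y) (ℕ.≤-trans y≥1 (ℕ.m≤n+m y x)) in
      k , card , (begin
        toℚ k                                   ≡⟨ k≡Ω ⟩
        eval (Ω Q fQ) (toℚ (x ℕ.+ y))            ≡⟨ cong (eval (Ω Q fQ)) (toℚ-+ x y) ⟩
        eval (Ω Q fQ) (toℚ x ℚ.+ toℚ y)          ≡⟨ eval-shift (Ω Q fQ) (toℚ x) (toℚ y) ⟨
        eval (shift (toℚ x) (Ω Q fQ)) (toℚ y)    ∎)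
      where open ≡-Reasoning

    -- The coefficient of yⁱ in cut x U d, as a polynomial in x.
    cut-coeff : ℕ → ∀ U → Dec (IsFilter Q U) → List ℚ
    cut-coeff i U (yes U-filter) =
      coeff (Ω (induced Q U) (F-filter fQ U-filter)) i ·ₚ Ω (induced Q (∁ U)) (F-ideal fQ U-filter)
    cut-coeff i U (no _) = []

    shift-coeff : ℕ → List ℚ
    shift-coeff i = foldSubsets _+ₚ_ (size Q) (λ U → cut-coeff i U (filter? U))

    coeff-shift≡shift-coeff : ∀ x → 1 ℕ.≤ x → ∀ i → coeff (shift (toℚ x) (Ω Q fQ)) i ≡ eval (shift-coeff i) (toℚ x)
    coeff-shift≡shift-coeff x x≥1 i = begin
      coeff (shift (toℚ x) (Ω Q fQ)) i
        ≡⟨ Counts-unique (shift-counts x) (Counts-partition (size Q) (λ _ → above (+ x)) cuts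
                                             (λ U → cut-counts x x≥1 U (filter? U))) i ⟩
      coeff (foldSubsets _+ₚ_ (size Q) cuts) i
        ≡⟨ foldSubsets-homo (λ p → coeff p i) (λ p q → coeff-+ₚ p q i) (size Q) cuts ⟩
      foldSubsets ℚ._+_ (size Q) (λ U → coeff (cuts U) i)
        ≡⟨ foldSubsets-cong ℚ._+_ (size Q) (λ U → cut≡cut-coeff U (filter? U)) ⟩
      foldSubsets ℚ._+_ (size Q) (λ U → eval (cut-coeff i U (filter? U)) (toℚ x))
        ≡⟨ foldSubsets-homo (λ p → eval p (toℚ x)) (λ p q → eval-+ₚ p q (toℚ x)) (size Q) _ ⟨
      eval (shift-coeff i) (toℚ x) ∎
      where
      open ≡-Reasoning
      cuts : Subset (size Q) → List ℚ
      cuts U = cut x U (filter? U)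
      cut≡cut-coeff : ∀ U d → coeff (cut x U d) i ≡ eval (cut-coeff i U d) (toℚ x)
      cut≡cut-coeff U (yes U-filter) = begin
        coeff (ΩU *ₚ (eval ΩQ∖U (toℚ x) ∷ [])) i   ≡⟨ coeff-*ₚ-const ΩU (eval ΩQ∖U (toℚ x)) i ⟩
        coeff ΩU i ℚ.* eval ΩQ∖U (toℚ x)          ≡⟨ eval-·ₚ (coeff ΩU i) ΩQ∖U (toℚ x) ⟨
        eval (coeff ΩU i ·ₚ ΩQ∖U) (toℚ x)          ∎
        where
        ΩU = Ω (induced Q U) (F-filter fQ U-filter)
        ΩQ∖U = Ω (induced Q (∁ U)) (F-ideal fQ U-filter)
      cut≡cut-coeff U (no _)  = refl

    Ω≗shift-coeff₀ : ∀ j → coeff (Ω Q fQ) j ≡ coeff (shift-coeff 0) j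
    Ω≗shift-coeff₀ = coeff-unique (Ω Q fQ) (shift-coeff 0) λ x x≥1 →
      trans (sym (coeff₀-shift (Ω Q fQ) (toℚ x))) (coeff-shift≡shift-coeff x x≥1 0)

    derivative-Ω≗shift-coeff₁ : ∀ j → coeff (derivative (Ω Q fQ)) j ≡ coeff (shift-coeff 1) j
    derivative-Ω≗shift-coeff₁ = coeff-unique (derivative (Ω Q fQ)) (shift-coeff 1) λ x x≥1 →
      trans (sym (coeff₁-shift (Ω Q fQ) (toℚ x))) (coeff-shift≡shift-coeff x x≥1 1)

  ΩInvariant : ∀ Q → F Q → Set
  ΩInvariant Q fQ = (∀ i → 0ℚ ℚ.≤ coeff (Ω Q fQ) i) × (size Q ≢ 0 → coeff (Ω Q fQ) 0 ≡ 0ℚ)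

  module InductionStep (Q : FinPoset) (fQ : F Q) (nonempty : size Q ≢ 0)
                        (IH : ∀ R fR → size R ℕ.< size Q → ΩInvariant R fR) where

    cut-coeff₁-nonneg : ∀ U d j → 0ℚ ℚ.≤ coeff (cut-coeff Q fQ 1 U d) j
    cut-coeff₁-nonneg U (no _)         j = ℚ.≤-refl
    cut-coeff₁-nonneg U (yes U-filter) j with ∣ U ∣ ℕ.≟ 0
    ... | yes ∣U∣≡0 = ℚ.≤-reflexive (sym (begin
      coeff (c ·ₚ Ω∖U) j       ≡⟨ coeff-·ₚ c Ω∖U j ⟩
      c ℚ.* coeff Ω∖U j        ≡⟨ cong (ℚ._* coeff Ω∖U j) (Ω-empty (induced Q U) fU ∣U∣≡0 1) ⟩
      0ℚ ℚ.* coeff Ω∖U j       ≡⟨ ℚ.*-zeroˡ (coeff Ω∖U j) ⟩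
      0ℚ                       ∎))
      where
      open ≡-Reasoning
      fU = F-filter fQ U-filter
      c = coeff (Ω (induced Q U) fU) 1
      Ω∖U = Ω (induced Q (∁ U)) (F-ideal fQ U-filter)
    ... | no ∣U∣≢0 = subst (0ℚ ℚ.≤_) (sym (coeff-·ₚ (coeff (Ω (induced Q U) fU) 1) (Ω (induced Q (∁ U)) fQ∖U) j))
      (*-nonNeg (proj₂ (proj₂ (linear-nonneg (induced Q U) fU)))
                (proj₁ (IH (induced Q (∁ U)) fQ∖U (∣∁p∣<n U ∣U∣≢0)) j))
      where
      fU = F-filter fQ U-filter
      fQ∖U = F-ideal fQ U-filter

    shift-coeff₁-nonneg : ∀ i → 0ℚ ℚ.≤ coeff (shift-coeff Q fQ 1) i
    shift-coeff₁-nonneg i =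
      subst (0ℚ ℚ.≤_) (sym (foldSubsets-homo (λ p → coeff p i) (λ p q → coeff-+ₚ p q i) (size Q) _))
        (foldSubsets-preserves ℚ._+_ (0ℚ ℚ.≤_) +-nonNeg (size Q)
          λ U → cut-coeff₁-nonneg U (filter? Q fQ U) i)

    coeff-suc-nonneg : ∀ i → 0ℚ ℚ.≤ coeff (Ω Q fQ) (suc i)
    coeff-suc-nonneg i = ℚ.*-cancelˡ-≤-pos (toℚ (suc i)) {{ℚ.positive (toℚ-suc-pos i)}} (begin
      toℚ (suc i) ℚ.* 0ℚ                       ≡⟨ ℚ.*-zeroʳ (toℚ (suc i)) ⟩
      0ℚ                                      ≤⟨ shift-coeff₁-nonneg i ⟩
      coeff (shift-coeff Q fQ 1) i                 ≡⟨ derivative-Ω≗shift-coeff₁ Q fQ i ⟨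
      coeff (derivative (Ω Q fQ)) i           ≡⟨ coeff-derivative (Ω Q fQ) i ⟩
      toℚ (suc i) ℚ.* coeff (Ω Q fQ) (suc i)   ∎)
      where open ℚ.≤-Reasoning

    cut-coeff₀-vanishes : ∀ U d → U ≢ ⊤ → U ≢ ⊥ → coeff (cut-coeff Q fQ 0 U d) 0 ≡ 0ℚ
    cut-coeff₀-vanishes U (no _)         U≢⊤ U≢⊥ = refl
    cut-coeff₀-vanishes U (yes U-filter) U≢⊤ U≢⊥ = begin
      coeff (coeff ΩU 0 ·ₚ Ω∖U) 0   ≡⟨ coeff-·ₚ (coeff ΩU 0) Ω∖U 0 ⟩
      coeff ΩU 0 ℚ.* coeff Ω∖U 0
        ≡⟨ cong (ℚ._* coeff Ω∖U 0) (proj₂ (IH (induced Q U) fU (∣p∣<n U ∣∁U∣≢0)) ∣U∣≢0) ⟩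
      0ℚ ℚ.* coeff Ω∖U 0            ≡⟨ ℚ.*-zeroˡ (coeff Ω∖U 0) ⟩
      0ℚ                            ∎
      where
      open ≡-Reasoning
      fU = F-filter fQ U-filter
      ΩU = Ω (induced Q U) fU
      Ω∖U = Ω (induced Q (∁ U)) (F-ideal fQ U-filter)
      ∣U∣≢0 : ∣ U ∣ ≢ 0
      ∣U∣≢0 = U≢⊥ ∘ ∣p∣≡0⇒p≡⊥ U
      ∣∁U∣≢0 : ∣ ∁ U ∣ ≢ 0
      ∣∁U∣≢0 = U≢⊤ ∘ ∣∁p∣≡0⇒p≡⊤ U

    cut-coeff₀-⊤ : ∀ d → coeff (cut-coeff Q fQ 0 ⊤ d) 0 ≡ coeff (Ω Q fQ) 0
    cut-coeff₀-⊤ (no ¬filter)   = contradiction (⊤-isFilter Q) ¬filter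
    cut-coeff₀-⊤ (yes ⊤-filter) = begin
      coeff (coeff Ω⊤ 0 ·ₚ Ω∅) 0   ≡⟨ coeff-·ₚ (coeff Ω⊤ 0) Ω∅ 0 ⟩
      coeff Ω⊤ 0 ℚ.* coeff Ω∅ 0
        ≡⟨ cong₂ ℚ._*_ (Ω-full Q fQ ⊤ _ refl 0) (Ω-empty (induced Q (∁ ⊤)) _ (∣∁⊤∣≡0 (size Q)) 0) ⟩
      coeff (Ω Q fQ) 0 ℚ.* 1ℚ      ≡⟨ ℚ.*-identityʳ _ ⟩
      coeff (Ω Q fQ) 0             ∎
      where
      open ≡-Reasoning
      Ω⊤ = Ω (induced Q ⊤) (F-filter fQ ⊤-filter)
      Ω∅ = Ω (induced Q (∁ ⊤)) (F-ideal fQ ⊤-filter)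

    cut-coeff₀-⊥ : ∀ d → coeff (cut-coeff Q fQ 0 ⊥ d) 0 ≡ coeff (Ω Q fQ) 0
    cut-coeff₀-⊥ (no ¬filter)   = contradiction (⊥-isFilter Q) ¬filter
    cut-coeff₀-⊥ (yes ⊥-filter) = begin
      coeff (coeff Ω∅ 0 ·ₚ Ω⊤) 0   ≡⟨ coeff-·ₚ (coeff Ω∅ 0) Ω⊤ 0 ⟩
      coeff Ω∅ 0 ℚ.* coeff Ω⊤ 0
        ≡⟨ cong₂ ℚ._*_ (Ω-empty (induced Q ⊥) _ (∣⊥∣≡0 (size Q)) 0) (Ω-full Q fQ (∁ ⊥) _ ∁⊥≡⊤ 0) ⟩
      1ℚ ℚ.* coeff (Ω Q fQ) 0      ≡⟨ ℚ.*-identityˡ _ ⟩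
      coeff (Ω Q fQ) 0             ∎
      where
      open ≡-Reasoning
      Ω∅ = Ω (induced Q ⊥) (F-filter fQ ⊥-filter)
      Ω⊤ = Ω (induced Q (∁ ⊥)) (F-ideal fQ ⊥-filter)

    -- Only the filters ⊤ and ⊥ contribute to the constant term, each with Ω_Q (0).
    constant-coeff≡0 : coeff (Ω Q fQ) 0 ≡ 0ℚ
    constant-coeff≡0 = x≡x+x⇒x≡0 (begin
      coeff (Ω Q fQ) 0
        ≡⟨ Ω≗shift-coeff₀ Q fQ 0 ⟩
      coeff (shift-coeff Q fQ 0) 0
        ≡⟨ foldSubsets-homo (λ p → coeff p 0) (λ p q → coeff-+ₚ p q 0) (size Q) _ ⟩
      foldSubsets ℚ._+_ (size Q) (λ U → coeff (cut-coeff₀ U) 0)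
        ≡⟨ foldSubsets-⊤⊥ (size Q) _ nonempty (λ U → cut-coeff₀-vanishes U (filter? Q fQ U)) ⟩
      coeff (cut-coeff₀ ⊤) 0 ℚ.+ coeff (cut-coeff₀ ⊥) 0
        ≡⟨ cong₂ ℚ._+_ (cut-coeff₀-⊤ (filter? Q fQ ⊤)) (cut-coeff₀-⊥ (filter? Q fQ ⊥)) ⟩
      coeff (Ω Q fQ) 0 ℚ.+ coeff (Ω Q fQ) 0 ∎)
      where
      open ≡-Reasoning
      cut-coeff₀ : Subset (size Q) → List ℚ
      cut-coeff₀ U = cut-coeff Q fQ 0 U (filter? Q fQ U)
      x≡x+x⇒x≡0 : ∀ {x} → x ≡ x ℚ.+ x → x ≡ 0ℚ
      x≡x+x⇒x≡0 {x} x≡x+x = begin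
        x                     ≡⟨ [x+x]-x≡x x ⟨
        (x ℚ.+ x) ℚ.- x       ≡⟨ cong (ℚ._- x) x≡x+x ⟨
        x ℚ.- x               ≡⟨ ℚ.+-inverseʳ x ⟩
        0ℚ                    ∎
        where
        [x+x]-x≡x : ∀ x → (x ℚ.+ x) ℚ.- x ≡ x
        [x+x]-x≡x = solve 1 (λ x → (x :+ x) :+ :- x := x) refl

  Ω-invariant : ∀ Q → Acc ℕ._<_ (size Q) → ∀ fQ → ΩInvariant Q fQ
  Ω-invariant Q (acc rec) fQ with size Q ℕ.≟ 0
  ... | yes size≡0 = (λ i → subst (0ℚ ℚ.≤_) (sym (Ω-empty Q fQ size≡0 i)) (coeff-nonNeg one≥0 i)) ,
                     contradiction size≡0
    where
    one≥0 : NonNeg (1ℚ ∷ [])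
    one≥0 = ℚ.<⇒≤ (ℚ.positive⁻¹ 1ℚ) ∷ []
  ... | no  size≢0 = (λ { zero → ℚ.≤-reflexive (sym constant-coeff≡0) ; (suc i) → coeff-suc-nonneg i }) ,
                     λ _ → constant-coeff≡0
    where open InductionStep Q fQ size≢0 (λ R fR R<Q → Ω-invariant R (rec R<Q) fR)

  Ω-nonNeg : ∀ Q fQ → NonNeg (Ω Q fQ)
  Ω-nonNeg Q fQ = nonNeg-coeff (Ω Q fQ) (proj₁ (Ω-invariant Q (<-wellFounded (size Q)) fQ))

  TopLayer : ∀ R → (s : ℤ) (lo hi : Fin (size R) → ℤ) → ℕ → Vec ℤ (size R) → Set
  TopLayer R s lo hi n = MonotoneWithin R (λ p z → Box R lo hi n p z × + n ℤ.* s ℤ.< z)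

  -- When every upper bound is s + 1, a map in the top layer is forced to equal n (s + 1)
  -- on the filter W generated by the elements with lower bound s + 1, and is an arbitrary
  -- map into the band (n s, n s + n] on the ideal outside W.
  module SaturatedTop (R : FinPoset) (fR : F R) (s : ℤ) (lo hi : Fin (size R) → ℤ)
                      (hi≡s+1 : ∀ p → hi p ≡ s ℤ.+ + 1) (lo≤s+1 : ∀ p → lo p ℤ.≤ s ℤ.+ + 1) where

    W : Subset (size R)
    W = upClosure R (decOrderF R fR) (select (λ p → lo p ℤ.≟ s ℤ.+ + 1))

    W-filter : IsFilter R W
    W-filter = upClosure-isFilter R (decOrderF R fR) _

    lo≤s-outside : ∀ j → lo (embed (∁ W) j) ℤ.≤ s
    lo≤s-outside j = subst (lo (embed (∁ W) j) ℤ.≤_) (pred[s+1]≡s s) (ℤ.i<j⇒i≤pred[j] (ℤ.≤∧≢⇒< (lo≤s+1 _) lo≢s+1))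
      where
      pred[s+1]≡s : ∀ s → ℤ.-1ℤ ℤ.+ (s ℤ.+ + 1) ≡ s
      pred[s+1]≡s = solve-∀
      lo≢s+1 : lo (embed (∁ W) j) ≢ s ℤ.+ + 1
      lo≢s+1 eq = x∈∁p⇒x∉p (embed-∈ (∁ W) j) (⊆-upClosure R _ _ (∈-select⁺ (λ p → lo p ℤ.≟ s ℤ.+ + 1) eq))

    module _ (n : ℕ) where

      top : ℤ
      top = + n ℤ.* (s ℤ.+ + 1)

      forced : ∀ g → TopLayer R s lo hi n g → ∀ i → lookup g (embed W i) ≡ top
      forced g (g-mono , g-within) i =
        let x = embed W i ; f , f∈S , ¬¬f≼x = ∈-upClosure⁻ R _ _ (embed-∈ W i)
            lo-f≡s+1 = ∈-select⁻ (λ p → lo p ℤ.≟ s ℤ.+ + 1) f∈S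
        in ℤ.≤-antisym
          (subst (lookup g x ℤ.≤_) (cong (+ n ℤ.*_) (hi≡s+1 x)) (proj₂ (proj₁ (g-within x))))
          (ℤ.≤-trans (subst (λ l → + n ℤ.* l ℤ.≤ lookup g f) lo-f≡s+1 (proj₁ (proj₁ (g-within f))))
                     (monotone-¬¬ R g g-mono ¬¬f≼x))

      split : ∀ g → TopLayer R s lo hi n g →
              restrict W g ≡ Vec.replicate _ top × Band (induced R (∁ W)) (+ n ℤ.* s) n (restrict (∁ W) g)
      split g g-top@(g-mono , g-within) =
        lookup-extensionality (λ i → trans (lookup-restrict W g i)
                                          (trans (forced g g-top i) (sym (Vec.lookup-replicate i top)))) ,
        restrict-monotone R (∁ W) g g-mono ,
        restrict-within R (∁ W) {λ _ → InBand (+ n ℤ.* s) n} g λ j →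
          proj₂ (g-within _) ,
          subst (_ ℤ.≤_) (trans (cong (+ n ℤ.*_) (hi≡s+1 _)) (*-suc n s)) (proj₂ (proj₁ (g-within _)))

      glue : 1 ℕ.≤ n → ∀ g₁ g₂ → g₁ ≡ Vec.replicate _ top → Band (induced R (∁ W)) (+ n ℤ.* s) n g₂ →
             TopLayer R s lo hi n (merge W g₁ g₂)
      glue n≥1 g₁ g₂ refl (g₂-mono , g₂-within) = mono , λ p → within p (side W p)
        where
        g = merge W g₁ g₂
        on-W : ∀ i → lookup g (embed W i) ≡ top
        on-W i = trans (lookup-merge-S W g₁ g₂ i) (Vec.lookup-replicate i top)
        below-top : ∀ j → lookup g₂ j ℤ.≤ top
        below-top j = subst (_ ℤ.≤_) (sym (*-suc n s)) (proj₂ (g₂-within j))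
        mono : Monotone R g
        mono p q p≼q with side W p | side W q
        ... | in-S i  | in-S i′  = ℤ.≤-reflexive (trans (on-W i) (sym (on-W i′)))
        ... | in-∁S j | in-∁S j′ = subst₂ ℤ._≤_ (sym (lookup-merge-∁S W g₁ g₂ j)) (sym (lookup-merge-∁S W g₁ g₂ j′))
                                     (g₂-mono j j′ p≼q)
        ... | in-∁S j | in-S i′  = subst₂ ℤ._≤_ (sym (lookup-merge-∁S W g₁ g₂ j)) (sym (on-W i′)) (below-top j)
        ... | in-S i  | in-∁S j′ = contradiction (W-filter _ _ p≼q (embed-∈ W i)) (x∈∁p⇒x∉p (embed-∈ (∁ W) j′))
        within : ∀ p → Side W p → Box R lo hi n p (lookup g p) × + n ℤ.* s ℤ.< lookup g p
        within _ (in-S i)  rewrite on-W i =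
          (*-mono-≤ n (lo≤s+1 _) , ℤ.≤-reflexive (cong (+ n ℤ.*_) (sym (hi≡s+1 _)))) ,
          *-mono-< n≥1 (subst (ℤ._< s ℤ.+ + 1) (ℤ.+-identityʳ s) (ℤ.+-monoʳ-< s (ℤ.+<+ ℕ.z<s)))
        within _ (in-∁S j) rewrite lookup-merge-∁S W g₁ g₂ j =
          (ℤ.≤-trans (*-mono-≤ n (lo≤s-outside j)) (ℤ.<⇒≤ (proj₁ (g₂-within j))) ,
           subst (_ ℤ.≤_) (cong (+ n ℤ.*_) (sym (hi≡s+1 _))) (below-top j)) ,
          proj₁ (g₂-within j)

    counts : Counts _ (TopLayer R s lo hi) (Ω (induced R (∁ W)) (F-ideal fR W-filter))
    counts = counting λ n n≥1 →
      let k , card , k≡Ω = represents (Ω-counts (induced R (∁ W)) (F-ideal fR W-filter) (λ n → + n ℤ.* s)) n n≥1 in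
      1 ℕ.* k , Card-split W (split n) (glue n n≥1) (Card-singleton _) card ,
      trans (cong toℚ (ℕ.*-identityˡ k)) k≡Ω

  top-layer : ∀ R → F R → (s : ℤ) (lo hi : Fin (size R) → ℤ) → (∀ p → hi p ℤ.≤ s ℤ.+ + 1) →
              ∃ λ c → NonNeg c × Counts _ (TopLayer R s lo hi) c
  top-layer R fR s lo hi hi≤s+1 with Fin.any? (λ p → hi p ℤ.≤? s)
  ... | yes (p , hi≤s) = [] , [] , Counts-∅ λ n _ g (_ , g-within) →
    let (_ , gp≤n·hi) , n·s<gp = g-within p in ℤ.<⇒≱ n·s<gp (ℤ.≤-trans gp≤n·hi (*-mono-≤ n hi≤s))
  ... | no  hi≰s with Fin.any? (λ p → s ℤ.+ + 1 ℤ.<? lo p)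
  ...   | yes (p , s+1<lo) = [] , [] , Counts-∅ λ n n≥1 g (_ , g-within) →
    let (n·lo≤gp , gp≤n·hi) , _ = g-within p in
    ℤ.<⇒≱ s+1<lo (ℤ.≤-trans (*-cancel-≤ n≥1 (ℤ.≤-trans n·lo≤gp gp≤n·hi)) (hi≤s+1 p))
  ...   | no  lo≯s+1 = Ω (induced R (∁ W)) (F-ideal fR W-filter) , Ω-nonNeg _ _ , counts
    where
    hi≡s+1 : ∀ p → hi p ≡ s ℤ.+ + 1
    hi≡s+1 p = ℤ.≤-antisym (hi≤s+1 p)
      (subst (ℤ._≤ hi p) (ℤ.+-comm (+ 1) s) (ℤ.i<j⇒suc[i]≤j (ℤ.≰⇒> λ hi≤s → hi≰s (p , hi≤s))))
    open SaturatedTop R fR s lo hi hi≡s+1 (λ p → ℤ.≮⇒≥ λ s+1<lo → lo≯s+1 (p , s+1<lo))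

  box-counts : ∀ d Q → F Q → (a : ℤ) (lo hi : Fin (size Q) → ℤ) →
               (∀ p → a ℤ.≤ lo p) → (∀ p → hi p ℤ.≤ a ℤ.+ + d) →
               ∃ λ c → NonNeg c × Counts _ (λ n → MonotoneWithin Q (Box Q lo hi n)) c
  box-counts zero Q fQ a lo hi a≤lo hi≤a = flat-box-counts Q a lo hi a≤lo hi≤a
  box-counts (suc d) Q fQ a lo hi a≤lo hi≤a+d+1 =
    foldSubsets _+ₚ_ (size Q) (proj₁ ∘ parts) ,
    foldSubsets-preserves _+ₚ_ NonNeg +ₚ-nonNeg (size Q) (proj₁ ∘ proj₂ ∘ parts) ,
    Counts-partition (size Q) (λ n → above (+ n ℤ.* s)) _ (proj₂ ∘ proj₂ ∘ parts)
    where
    s : ℤ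
    s = a ℤ.+ + d
    hi≤s+1 : ∀ p → hi p ℤ.≤ s ℤ.+ + 1
    hi≤s+1 p = subst (hi p ℤ.≤_) (a+[1+d]≡[a+d]+1 a (+ d)) (hi≤a+d+1 p)
      where
      a+[1+d]≡[a+d]+1 : ∀ a d → a ℤ.+ (+ 1 ℤ.+ d) ≡ (a ℤ.+ d) ℤ.+ + 1
      a+[1+d]≡[a+d]+1 = solve-∀
    part : ∀ U → Dec (IsFilter Q U) →
           ∃ λ c → NonNeg c × Counts _ (λ n → WithinAbove Q (+ n ℤ.* s) (Box Q lo hi n) U) c
    part U (no ¬filter) = [] , [] , Counts-∅ λ n _ g ((g-mono , _) , above≡U) →
      ¬filter (subst (IsFilter Q) above≡U (above-isFilter Q (+ n ℤ.* s) g g-mono))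
    part U (yes U-filter) =
      let c₁ , c₁≥0 , top    = top-layer (induced Q U) (F-filter fQ U-filter) s (lo ∘ embed U) (hi ∘ embed U)
                                 (hi≤s+1 ∘ embed U)
          c₂ , c₂≥0 , bottom = box-counts d (induced Q (∁ U)) (F-ideal fQ U-filter) a (lo ∘ embed (∁ U))
                                 (λ j → hi (embed (∁ U) j) ℤ.⊓ s) (a≤lo ∘ embed (∁ U)) (λ j → ℤ.i⊓j≤j _ s)
      in c₁ *ₚ c₂ , *ₚ-nonNeg c₁≥0 c₂≥0 ,
         Counts-threshold Q (λ n → + n ℤ.* s) (Box Q lo hi) U U-filter top
           (Counts-bounds (induced Q (∁ U))
              {λ n → Box (induced Q (∁ U)) (lo ∘ embed (∁ U)) (λ j → hi (embed (∁ U) j) ℤ.⊓ s) n}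
              {λ n → BoundsBelow Q (+ n ℤ.* s) (Box Q lo hi n) U} bottom
              (λ n _ j z (n·lo≤z , z≤n·[hi⊓s]) →
                 let z≤ = subst (z ℤ.≤_) (ℤ.*-distribˡ-⊓-nonNeg (+ n) _ s) z≤n·[hi⊓s] in
                 (n·lo≤z , ℤ.i≤j⊓k⇒i≤j _ _ z≤) , ℤ.i≤j⊓k⇒i≤k _ _ z≤)
              (λ n _ j z ((n·lo≤z , z≤n·hi) , z≤n·s) →
                 n·lo≤z , subst (z ℤ.≤_) (sym (ℤ.*-distribˡ-⊓-nonNeg (+ n) _ s)) (ℤ.⊓-glb z≤n·hi z≤n·s)))
    parts : ∀ U → ∃ λ c → NonNeg c × Counts _ (λ n → WithinAbove Q (+ n ℤ.* s) (Box Q lo hi n) U) c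
    parts U = part U (filter? Q fQ U)

-- Marked order polytopes

bounded : ∀ {n} (f : Fin n → ℤ) → ∃₂ λ a b → a ℤ.≤ b × ∀ p → a ℤ.≤ f p × f p ℤ.≤ b
bounded {zero}  f = + 0 , + 0 , ℤ.≤-refl , λ ()
bounded {suc n} f =
  let a , b , a≤b , a≤f≤b = bounded (f ∘ suc) in
  f zero ℤ.⊓ a , f zero ℤ.⊔ b , ℤ.≤-trans (ℤ.i⊓j≤i _ a) (ℤ.i≤i⊔j _ b) ,
  λ { zero    → ℤ.i⊓j≤i _ a , ℤ.i≤i⊔j _ b
    ; (suc p) → ℤ.≤-trans (ℤ.i⊓j≤j _ a) (proj₁ (a≤f≤b p)) , ℤ.≤-trans (proj₂ (a≤f≤b p)) (ℤ.i≤j⊔i _ b) }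

-- Unmarked elements get the bounds a ≤ λ ≤ b, which they satisfy automatically because they lie
-- between a marked minimal and a marked maximal element.
module MarkedBox (P : FinPoset) (_≼?_ : DecOrder P) (A : Subset (size P))
                 (min-max-marked : MinMaxMarked P A) (λ′ : Marking P A) where

  marked-or : ℤ → Fin (size P) → ℤ
  marked-or default p with p ∈? A
  ... | yes p∈A = λ′ p p∈A
  ... | no  _   = default

  marked-or-∈ : ∀ default {p} (p∈A : p ∈ A) → marked-or default p ≡ λ′ p p∈A
  marked-or-∈ default {p} p∈A with p ∈? A
  ... | yes p∈A′ = cong (λ′ p) ([]=-irrelevant p∈A′ p∈A)
  ... | no  p∉A  = contradiction p∈A p∉A

  private
    marking-bounds : ∃₂ λ a b → a ℤ.≤ b × ∀ p → a ℤ.≤ marked-or (+ 0) p × marked-or (+ 0) p ℤ.≤ b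
    marking-bounds = bounded (marked-or (+ 0))

  a b : ℤ
  a = proj₁ marking-bounds
  b = proj₁ (proj₂ marking-bounds)

  a≤b : a ℤ.≤ b
  a≤b = proj₁ (proj₂ (proj₂ marking-bounds))

  d : ℕ
  d = ℤ.∣ b ℤ.- a ∣

  a≤λ≤b : ∀ {p} (p∈A : p ∈ A) → a ℤ.≤ λ′ p p∈A × λ′ p p∈A ℤ.≤ b
  a≤λ≤b {p} p∈A = subst (λ v → a ℤ.≤ v × v ℤ.≤ b) (marked-or-∈ (+ 0) p∈A)
                    (proj₂ (proj₂ (proj₂ marking-bounds)) p)

  lo hi : Fin (size P) → ℤ
  lo = marked-or a
  hi = marked-or b

  a≤lo : ∀ p → a ℤ.≤ lo p
  a≤lo p with p ∈? A
  ... | yes p∈A = proj₁ (a≤λ≤b p∈A)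
  ... | no  _   = ℤ.≤-refl

  hi≤a+d : ∀ p → hi p ℤ.≤ a ℤ.+ + d
  hi≤a+d p = subst (hi p ℤ.≤_) (sym a+d≡b) (hi≤b p)
    where
    a+[b-a]≡b : ∀ a b → a ℤ.+ (b ℤ.- a) ≡ b
    a+[b-a]≡b = solve-∀
    a+d≡b : a ℤ.+ + d ≡ b
    a+d≡b = trans (cong (λ z → a ℤ.+ z) (ℤ.0≤i⇒+∣i∣≡i (ℤ.i≤j⇒0≤j-i a≤b))) (a+[b-a]≡b a b)
    hi≤b : ∀ p → hi p ℤ.≤ b
    hi≤b p with p ∈? A
    ... | yes p∈A = proj₂ (a≤λ≤b p∈A)
    ... | no  _   = ℤ.≤-refl

  module _ (n : ℕ) (g : Vec ℤ (size P)) where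

    box⇒marked : MonotoneWithin P (Box P lo hi n) g → InDilatedMOP P A λ′ n g
    box⇒marked (g-mono , g-within) = g-mono , λ x x∈A → ℤ.≤-antisym
      (subst (λ v → lookup g x ℤ.≤ + n ℤ.* v) (marked-or-∈ b x∈A) (proj₂ (g-within x)))
      (subst (λ v → + n ℤ.* v ℤ.≤ lookup g x) (marked-or-∈ a x∈A) (proj₁ (g-within x)))

    marked⇒box : InDilatedMOP P A λ′ n g → MonotoneWithin P (Box P lo hi n) g
    marked⇒box (g-mono , g-marked) = g-mono , within
      where
      n·a≤ : ∀ p → + n ℤ.* a ℤ.≤ lookup g p
      n·a≤ p = let m , ¬¬m≼p , m-minimal = minimal-below P _≼?_ p ; m∈A = min-max-marked m (inj₁ m-minimal) in
        ℤ.≤-trans (*-mono-≤ n (proj₁ (a≤λ≤b m∈A)))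
                  (ℤ.≤-trans (ℤ.≤-reflexive (sym (g-marked m m∈A))) (monotone-¬¬ P g g-mono ¬¬m≼p))
      ≤n·b : ∀ p → lookup g p ℤ.≤ + n ℤ.* b
      ≤n·b p = let M , ¬¬p≼M , M-maximal = maximal-above P _≼?_ p ; M∈A = min-max-marked M (inj₂ M-maximal) in
        ℤ.≤-trans (monotone-¬¬ P g g-mono ¬¬p≼M)
                  (ℤ.≤-trans (ℤ.≤-reflexive (g-marked M M∈A)) (*-mono-≤ n (proj₂ (a≤λ≤b M∈A))))
      within : ∀ p → Box P lo hi n p (lookup g p)
      within p with p ∈? A
      ... | yes p∈A = ℤ.≤-reflexive (sym (g-marked p p∈A)) , ℤ.≤-reflexive (g-marked p p∈A)
      ... | no  _   = n·a≤ p , ≤n·b p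

theorem1p4 : (F : FinPoset → Set) → ClosedUnderIdealsFilters F
    → (∀ P → F P → LinearCoeffNonneg P)
    → ∀ P → F P → (A : Subset (size P)) → MinMaxMarked P A
    → (λ' : Marking P A) → EhrhartPositiveMOP P A λ'
theorem1p4 F closed linear-nonneg P fP A min-max-marked λ′ =
  let c , c≥0 , box = box-counts d P fP a lo hi a≤lo hi≤a+d in
  c , represents (Counts-resp box (λ n _ → box⇒marked n) (λ n _ → marked⇒box n)) , c≥0
  where
  open Family F closed linear-nonneg using (decOrderF; box-counts)
  open MarkedBox P (decOrderF P fP) A min-max-marked λ′
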